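{- Let $n=p_1^{\alpha_1}p_2^{\alpha_2}p_3^{\alpha_3}$, where $\alpha_1,\alpha_2,\alpha_3$ are positive integers and $p_1<p_2<p_3$ are prime numbers. Then $$\delta(\mathcal{P}(C_n))=\min\{\deg(p_2^{\alpha_2}),\ \deg(p_3^{\alpha_3})\}.$$
   Context: For a finite group $G$, the power graph $\mathcal{P}(G)$ is the simple undirected graph with vertex set $G$ in which two distinct vertices are adjacent if one of them is an integral power of the other. $C_n$ denotes the cyclic group of order $n$, identified with $\mathbb{Z}_n=\{0,1,\ldots,n-1\}$; a positive divisor $d$ of $n$ is regarded as the vertex $d \bmod n$. $\deg(a)$ denotes the degree of vertex $a$ in $\mathcal{P}(C_n)$ and $\delta(\mathcal{P}(C_n))$ the minimum degree. -}

module Defs where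

open import Data.Nat using (ℕ; zero; suc; _*_; _%_)
open import Data.Nat.Properties using () renaming (_≟_ to _≟ℕ_)
open import Data.Fin using (Fin; toℕ; _≟_)
open import Data.Fin.Properties using (any?)
open import Data.List using (List; length; filter)
open import Data.Fin.Base using ()
open import Data.List using ()
open import Data.Product using (∃; _×_; _,_)
open import Data.Sum using (_⊎_)
open import Relation.Nullary using (¬_; Dec; yes; no)
open import Relation.Nullary.Decidable using (_×-dec_; _⊎-dec_; ¬?)
open import Relation.Binary.PropositionalEquality using (_≡_)
import Data.List as L
import Data.Fin as F

-- The cyclic group C_n is identified with ℤ_n = Fin n (additive notation).
-- An integral power of a is, additively, an integer multiple k·a mod n;
-- since k·a mod n depends only on k mod n, it suffices to take k ∈ {0,…,n-1}.
IsPowerOf : {n : ℕ} → Fin n → Fin n → Set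
IsPowerOf {zero}  ()
IsPowerOf {suc m} b a = ∃ λ (k : Fin (suc m)) → (toℕ k * toℕ a) % suc m ≡ toℕ b

isPowerOf? : {n : ℕ} → (b a : Fin n) → Dec (IsPowerOf b a)
isPowerOf? {zero}  ()
isPowerOf? {suc m} b a = any? λ k → ((toℕ k * toℕ a) % suc m) ≟ℕ toℕ b

Adj : {n : ℕ} → Fin n → Fin n → Set
Adj a b = ¬ (a ≡ b) × (IsPowerOf a b ⊎ IsPowerOf b a)

adj? : {n : ℕ} → (a b : Fin n) → Dec (Adj a b)
adj? a b = ¬? (a ≟ b) ×-dec (isPowerOf? a b ⊎-dec isPowerOf? b a)

deg : {n : ℕ} → Fin n → ℕ
deg {n} a = length (filter (adj? a) (L.allFin n))

IsMinDegree : (n : ℕ) → ℕ → Set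
IsMinDegree n m = ((a : Fin n) → m Data.Nat.≤ deg a) × (∃ λ (a : Fin n) → deg a ≡ m)

module Submission where

-- Identify C_n with ℤ_n; b is a power of a iff gcd(a, n) ∣ b
-- (PowerRelation).  Hence b is adjacent to a iff b ≠ a and b lies below a
-- (gcd(a, n) ∣ b) or above a (gcd(b, n) ∣ a).  Both conditions split over
-- the prime powers p^A, q^B, r^C, and by the Chinese remainder theorem every
-- count over ℤ_n is a product of three local counts (Sums, CRT,
-- PrimePowers, LocalCounts).  If a has order p^s₁ q^s₂ r^s₃,
-- inclusion–exclusion gives the degree formula (DegreeFormula)
--     deg a + 1 + ∏ gen = ∏ below + ∏ above.
-- Through this formula the theorem becomes an inequality (DegreeComparison):
-- the configuration of every element dominates that of v₂ = q^B (order
-- exponents (A, 0, C)) or that of v₃ = r^C (exponents (A, B, 0)).  For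
-- s ≥ 1 the local counts are affine in p^(s-1), so along each coordinate the
-- extreme cases s ∈ {0, 1, A} are the worst; the remaining 27 polynomial
-- inequalities are decided by a certified coefficient comparison
-- (Normaliser).

open import Defs
open import Data.Nat using (ℕ; _*_; _^_; _<_; _⊓_)
open import Data.Nat.Primality using (Prime)
open import Data.Fin using (Fin; toℕ)
open import Relation.Binary.PropositionalEquality using (_≡_; _≢_; sym)
open import Data.Nat using (suc; _+_)
open import Data.Nat.Properties using (_≤?_; m≤n⇒m⊓n≡m; m≥n⇒m⊓n≡n; ≰⇒>; <⇒≤)
open import Data.Product using (∃; _,_)
open import Function using (_∘_)
open import Relation.Nullary using (yes; no)

module Sums where

  open import Data.Nat
  open import Data.Nat.Properties
  open import Data.Nat.Divisibility
  open import Data.Empty using (⊥-elim)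
  open import Relation.Nullary using (Dec; yes; no; ¬_)
  open import Relation.Nullary.Decidable using (_×-dec_; _⊎-dec_)
  open import Relation.Binary.PropositionalEquality
  open import Function using (_∘_)
  open import Algebra.Properties.CommutativeSemigroup +-commutativeSemigroup
    using () renaming (interchange to +-interchange)

  ΣN : ℕ → (ℕ → ℕ) → ℕ
  ΣN zero f = 0
  ΣN (suc n) f = f 0 + ΣN n (f ∘ suc)

  ΣN-cong : ∀ n {f g : ℕ → ℕ} → (∀ i → i < n → f i ≡ g i) → ΣN n f ≡ ΣN n g
  ΣN-cong zero h = refl
  ΣN-cong (suc n) h = cong₂ _+_ (h 0 z<s) (ΣN-cong n (λ i i<n → h (suc i) (s<s i<n)))

  ΣN-+ : ∀ n (f g : ℕ → ℕ) → ΣN n (λ i → f i + g i) ≡ ΣN n f + ΣN n g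
  ΣN-+ zero f g = refl
  ΣN-+ (suc n) f g =
    trans (cong (f 0 + g 0 +_) (ΣN-+ n (f ∘ suc) (g ∘ suc))) (+-interchange (f 0) (g 0) _ _)

  ΣN-*ˡ : ∀ n c (f : ℕ → ℕ) → ΣN n (λ i → c * f i) ≡ c * ΣN n f
  ΣN-*ˡ zero c f = sym (*-zeroʳ c)
  ΣN-*ˡ (suc n) c f = trans (cong (c * f 0 +_) (ΣN-*ˡ n c (f ∘ suc))) (sym (*-distribˡ-+ c (f 0) _))

  ΣN-*ʳ : ∀ n c (f : ℕ → ℕ) → ΣN n (λ i → f i * c) ≡ ΣN n f * c
  ΣN-*ʳ n c f = trans (ΣN-cong n (λ i _ → *-comm (f i) c)) (trans (ΣN-*ˡ n c f) (*-comm c _))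

  ΣN-zero : ∀ n → ΣN n (λ _ → 0) ≡ 0
  ΣN-zero zero = refl
  ΣN-zero (suc n) = ΣN-zero n

  ΣN-ones : ∀ n → ΣN n (λ _ → 1) ≡ n
  ΣN-ones zero = refl
  ΣN-ones (suc n) = cong suc (ΣN-ones n)

  ΣN-split : ∀ m k (f : ℕ → ℕ) → ΣN (m + k) f ≡ ΣN m f + ΣN k (λ i → f (m + i))
  ΣN-split zero k f = refl
  ΣN-split (suc m) k f = trans (cong (f 0 +_) (ΣN-split m k (f ∘ suc))) (sym (+-assoc (f 0) _ _))

  ΣN-swap : ∀ m k (f : ℕ → ℕ → ℕ) → ΣN m (λ i → ΣN k (f i)) ≡ ΣN k (λ j → ΣN m (λ i → f i j))
  ΣN-swap zero k f = sym (ΣN-zero k)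
  ΣN-swap (suc m) k f =
    trans (cong (ΣN k (f 0) +_) (ΣN-swap m k (f ∘ suc)))
          (sym (ΣN-+ k (f 0) (λ j → ΣN m (λ i → f (suc i) j))))

  ΣN-bound : ∀ K B (f : ℕ → ℕ) → (∀ i → i < K → f i ≤ B) → ΣN K f ≤ K * B
  ΣN-bound zero B f h = z≤n
  ΣN-bound (suc K) B f h = +-mono-≤ (h 0 z<s) (ΣN-bound K B (f ∘ suc) (λ i i<K → h (suc i) (s<s i<K)))

  ΣN-tight : ∀ K B (f : ℕ → ℕ) → (∀ i → i < K → f i ≤ B) → ΣN K f ≡ K * B → ∀ i → i < K → f i ≡ B
  ΣN-tight (suc K) B f h total i i<K = term i i<K
    where
    bound-rest : ΣN K (f ∘ suc) ≤ K * B
    bound-rest = ΣN-bound K B (f ∘ suc) (λ i i<K → h (suc i) (s<s i<K))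
    head≡B : f 0 ≡ B
    head≡B = ≤-antisym (h 0 z<s)
      (+-cancelʳ-≤ (K * B) B (f 0) (≤-trans (≤-reflexive (sym total)) (+-monoʳ-≤ (f 0) bound-rest)))
    rest≡ : ΣN K (f ∘ suc) ≡ K * B
    rest≡ = +-cancelˡ-≡ B _ _ (trans (cong (_+ ΣN K (f ∘ suc)) (sym head≡B)) total)
    term : ∀ i → i < suc K → f i ≡ B
    term zero _ = head≡B
    term (suc i) (s<s i<K) = ΣN-tight K B (f ∘ suc) (λ j j<K → h (suc j) (s<s j<K)) rest≡ i i<K

  ind : ∀ {a} {A : Set a} → Dec A → ℕ
  ind (yes _) = 1
  ind (no _) = 0

  ind-iff : ∀ {a b} {A : Set a} {B : Set b} → (A → B) → (B → A) → (dA : Dec A) (dB : Dec B) → ind dA ≡ ind dB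
  ind-iff f g (yes x) (yes y) = refl
  ind-iff f g (yes x) (no ny) = ⊥-elim (ny (f x))
  ind-iff f g (no nx) (yes y) = ⊥-elim (nx (g y))
  ind-iff f g (no nx) (no ny) = refl

  ind-× : ∀ {a b} {A : Set a} {B : Set b} (dA : Dec A) (dB : Dec B) → ind (dA ×-dec dB) ≡ ind dA * ind dB
  ind-× (yes x) (yes y) = refl
  ind-× (yes x) (no y) = refl
  ind-× (no x) (yes y) = refl
  ind-× (no x) (no y) = refl

  ind-⊎ : ∀ {a b} {A : Set a} {B : Set b} (dA : Dec A) (dB : Dec B) →
          ind (dA ⊎-dec dB) + ind (dA ×-dec dB) ≡ ind dA + ind dB
  ind-⊎ (yes x) (yes y) = refl
  ind-⊎ (yes x) (no y) = refl
  ind-⊎ (no x) (yes y) = refl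
  ind-⊎ (no x) (no y) = refl

  ind-yes : ∀ {a} {A : Set a} (dA : Dec A) → A → ind dA ≡ 1
  ind-yes (yes _) _ = refl
  ind-yes (no n) x = ⊥-elim (n x)

  ind-no : ∀ {a} {A : Set a} (dA : Dec A) → ¬ A → ind dA ≡ 0
  ind-no (yes x) n = ⊥-elim (n x)
  ind-no (no _) _ = refl

  δ : ℕ → ℕ → ℕ
  δ x i = ind (x ≟ i)

  ΣN-delta : ∀ M x (h : ℕ → ℕ) → x < M → ΣN M (λ i → δ x i * h i) ≡ h x
  ΣN-delta (suc M) zero h _ =
    trans (cong₂ _+_ (+-identityʳ (h 0))
                     (trans (ΣN-cong M (λ i _ → cong (_* h (suc i)) (ind-no (0 ≟ suc i) (λ ())))) (ΣN-zero M)))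
          (+-identityʳ (h 0))
  ΣN-delta (suc M) (suc x) h (s<s x<M) =
    trans (cong₂ _+_ (cong (_* h 0) (ind-no (suc x ≟ 0) (λ ())))
                     (ΣN-cong M (λ i _ → cong (_* h (suc i)) (ind-iff (cong pred) (cong suc) (suc x ≟ suc i) (x ≟ i)))))
          (ΣN-delta M x (h ∘ suc) x<M)

  ΣN-unique : ∀ K (P : ℕ → Set) (P? : ∀ i → Dec (P i)) →
    (∀ i j → i < K → j < K → P i → P j → i ≡ j) → ΣN K (λ i → ind (P? i)) ≤ 1
  ΣN-unique zero P P? u = z≤n
  ΣN-unique (suc K) P P? u with P? 0
  ... | yes p0 = ≤-reflexive (cong suc (trans (ΣN-cong K (λ i i<K → ind-no (P? (suc i)) (λ pi → 0≢1+n (u 0 (suc i) z<s (s<s i<K) p0 pi)))) (ΣN-zero K)))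
  ... | no _ = ΣN-unique K (P ∘ suc) (P? ∘ suc) (λ i j i<K j<K pi pj → cong pred (u (suc i) (suc j) (s<s i<K) (s<s j<K) pi pj))

  ΣN-multiples-one : ∀ d → .{{_ : NonZero d}} → ΣN d (λ i → ind (d ∣? i)) ≡ 1
  ΣN-multiples-one (suc d) = cong₂ _+_ (ind-yes (suc d ∣? 0) (suc d ∣0))
    (trans (ΣN-cong d (λ i i<d → ind-no (suc d ∣? suc i) (λ dv → <⇒≱ (s<s i<d) (∣⇒≤ dv)))) (ΣN-zero d))

  ΣN-multiples : ∀ k d → .{{_ : NonZero d}} → ΣN (k * d) (λ i → ind (d ∣? i)) ≡ k
  ΣN-multiples zero d = refl
  ΣN-multiples (suc k) d =
    trans (ΣN-split d (k * d) _)
          (cong₂ _+_ (ΣN-multiples-one d)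
                     (trans (ΣN-cong (k * d) (λ i _ → ind-iff (λ h → ∣m+n∣m⇒∣n h ∣-refl) (λ h → ∣m∣n⇒∣m+n ∣-refl h) (d ∣? (d + i)) (d ∣? i)))
                            (ΣN-multiples k d)))

module CRT where

  open import Data.Nat
  open import Data.Nat.Properties
  open import Data.Nat.Divisibility
  open import Data.Nat.DivMod
  open import Data.Nat.Coprimality using (Coprime; coprime-divisor)
  import Data.Nat.Coprimality as Coprimality
  open import Data.Product using (_×_; _,_)
  open import Data.Sum using (inj₁; inj₂)
  open import Data.Empty using (⊥-elim)
  open import Relation.Nullary.Decidable using (_×-dec_)
  open import Relation.Binary.PropositionalEquality
  open import Algebra.Properties.CommutativeSemigroup *-commutativeSemigroup
    using () renaming (interchange to *-interchange)
  open Sums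

  sameResidue⇒∣ : ∀ b t M .{{_ : NonZero M}} → (b + t) % M ≡ b % M → M ∣ t
  sameResidue⇒∣ b t M h = divides ((b + t) / M ∸ b / M) (sym difference)
    where
    q₁ : ℕ
    q₁ = (b + t) / M
    q₀ : ℕ
    q₀ = b / M
    quotients : q₀ * M + t ≡ q₁ * M
    quotients = +-cancelˡ-≡ (b % M) _ _ (begin
      b % M + (q₀ * M + t)   ≡⟨ sym (+-assoc (b % M) (q₀ * M) t) ⟩
      b % M + q₀ * M + t     ≡⟨ cong (_+ t) (sym (m≡m%n+[m/n]*n b M)) ⟩
      b + t                  ≡⟨ m≡m%n+[m/n]*n (b + t) M ⟩
      (b + t) % M + q₁ * M   ≡⟨ cong (_+ q₁ * M) h ⟩
      b % M + q₁ * M         ∎)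
      where open ≡-Reasoning
    difference : (q₁ ∸ q₀) * M ≡ t
    difference = trans (*-distribʳ-∸ M q₁ q₀)
                       (trans (cong (_∸ q₀ * M) (sym quotients)) (m+n∸m≡n (q₀ * M) t))

  coprime-∣-* : ∀ {M N t} → Coprime M N → M ∣ t → N ∣ t → M * N ∣ t
  coprime-∣-* {M} {N} {t} c (divides k refl) nt
    with coprime-divisor (Coprimality.sym c) (subst (N ∣_) (*-comm k M) nt)
  ... | divides k' refl = divides k' (trans (*-assoc k' N M) (cong (k' *_) (*-comm N M)))

  uniqueCRT-≤ : ∀ M N .{{_ : NonZero M}} .{{_ : NonZero N}} → Coprime M N → ∀ b b' → b ≤ b' →
    b' < M * N → b % M ≡ b' % M → b % N ≡ b' % N → b ≡ b'
  uniqueCRT-≤ M N c b b' le lb' hM hN = begin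
    b            ≡⟨ sym (+-identityʳ b) ⟩
    b + 0        ≡⟨ cong (b +_) (sym gap≡0) ⟩
    b + (b' ∸ b) ≡⟨ m+[n∸m]≡n le ⟩
    b'           ∎
    where
    open ≡-Reasoning
    gap-div : ∀ K .{{_ : NonZero K}} → b % K ≡ b' % K → K ∣ b' ∸ b
    gap-div K h = sameResidue⇒∣ b (b' ∸ b) K (trans (cong (_% K) (m+[n∸m]≡n le)) (sym h))
    gap≡0 : b' ∸ b ≡ 0
    gap≡0 with b' ∸ b | coprime-∣-* c (gap-div M hM) (gap-div N hN) | m∸n≤m b' b
    ... | zero  | _ | _ = refl
    ... | suc g | d | g≤b' = ⊥-elim (<⇒≱ (≤-<-trans g≤b' lb') (∣⇒≤ d))

  uniqueCRT : ∀ M N .{{_ : NonZero M}} .{{_ : NonZero N}} → Coprime M N → ∀ b b' →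
    b < M * N → b' < M * N → b % M ≡ b' % M → b % N ≡ b' % N → b ≡ b'
  uniqueCRT M N c b b' lb lb' hM hN with ≤-total b b'
  ... | inj₁ b≤b' = uniqueCRT-≤ M N c b b' b≤b' lb' hM hN
  ... | inj₂ b'≤b = sym (uniqueCRT-≤ M N c b' b b'≤b lb (sym hM) (sym hN))

  module _ (M N : ℕ) .{{_ : NonZero M}} .{{_ : NonZero N}} (cop : Coprime M N) where

    hits : ℕ → ℕ → ℕ → ℕ
    hits i j b = δ (b % M) i * δ (b % N) j

    -- Existence part of the CRT, in counting form: every residue pair is hit
    -- exactly once, since each is hit at most once and there are M·N hits.
    count : ℕ → ℕ → ℕ
    count i j = ΣN (M * N) (hits i j)

    count≤1 : ∀ i j → count i j ≤ 1
    count≤1 i j = subst (_≤ 1) (ΣN-cong (M * N) (λ b _ → ind-× (b % M ≟ i) (b % N ≟ j)))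
      (ΣN-unique (M * N) (λ b → (b % M ≡ i) × (b % N ≡ j)) (λ b → (b % M ≟ i) ×-dec (b % N ≟ j))
        (λ b b' lb lb' (h₁ , h₂) (h₁' , h₂') → uniqueCRT M N cop b b' lb lb' (trans h₁ (sym h₁')) (trans h₂ (sym h₂'))))

    δ-sum : ∀ K .{{_ : NonZero K}} b → ΣN K (δ (b % K)) ≡ 1
    δ-sum K b = trans (ΣN-cong K (λ i _ → sym (*-identityʳ (δ (b % K) i))))
                      (ΣN-delta K (b % K) (λ _ → 1) (m%n<n b K))

    count-total : ΣN M (λ i → ΣN N (λ j → count i j)) ≡ M * N
    count-total = begin
      ΣN M (λ i → ΣN N (λ j → ΣN (M * N) (hits i j)))
        ≡⟨ ΣN-cong M (λ i _ → sym (ΣN-swap (M * N) N (λ b j → hits i j b))) ⟩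
      ΣN M (λ i → ΣN (M * N) (λ b → ΣN N (λ j → hits i j b)))
        ≡⟨ ΣN-cong M (λ i _ → ΣN-cong (M * N) (λ b _ → row i b)) ⟩
      ΣN M (λ i → ΣN (M * N) (λ b → δ (b % M) i))
        ≡⟨ ΣN-swap M (M * N) (λ i b → δ (b % M) i) ⟩
      ΣN (M * N) (λ b → ΣN M (δ (b % M)))
        ≡⟨ ΣN-cong (M * N) (λ b _ → δ-sum M b) ⟩
      ΣN (M * N) (λ _ → 1)
        ≡⟨ ΣN-ones (M * N) ⟩
      M * N ∎
      where
      open ≡-Reasoning
      row : ∀ i b → ΣN N (λ j → hits i j b) ≡ δ (b % M) i
      row i b = trans (ΣN-*ˡ N (δ (b % M) i) (δ (b % N)))
                      (trans (cong (δ (b % M) i *_) (δ-sum N b)) (*-identityʳ _))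

    count≡1 : ∀ i j → i < M → j < N → count i j ≡ 1
    count≡1 i j i<M j<N =
      ΣN-tight N 1 (count i) (λ j _ → count≤1 i j) (trans row-total (sym (*-identityʳ N))) j j<N
      where
      row-bound : ∀ i → ΣN N (count i) ≤ N
      row-bound i = subst (ΣN N (count i) ≤_) (*-identityʳ N) (ΣN-bound N 1 (count i) (λ j _ → count≤1 i j))
      row-total : ΣN N (count i) ≡ N
      row-total = ΣN-tight M N (λ i → ΣN N (count i)) (λ i _ → row-bound i) count-total i i<M

    δδ-sum : ∀ f g x y → x < M → y < N →
      ΣN M (λ i → ΣN N (λ j → (δ x i * δ y j) * (f i * g j))) ≡ f x * g y
    δδ-sum f g x y x<M y<N = begin
      ΣN M (λ i → ΣN N (λ j → (δ x i * δ y j) * (f i * g j)))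
        ≡⟨ ΣN-cong M (λ i _ → ΣN-cong N (λ j _ → *-interchange (δ x i) (δ y j) (f i) (g j))) ⟩
      ΣN M (λ i → ΣN N (λ j → (δ x i * f i) * (δ y j * g j)))
        ≡⟨ ΣN-cong M (λ i _ → ΣN-*ˡ N (δ x i * f i) (λ j → δ y j * g j)) ⟩
      ΣN M (λ i → (δ x i * f i) * ΣN N (λ j → δ y j * g j))
        ≡⟨ ΣN-cong M (λ i _ → cong ((δ x i * f i) *_) (ΣN-delta N y g y<N)) ⟩
      ΣN M (λ i → (δ x i * f i) * g y)
        ≡⟨ ΣN-*ʳ M (g y) (λ i → δ x i * f i) ⟩
      ΣN M (λ i → δ x i * f i) * g y
        ≡⟨ cong (_* g y) (ΣN-delta M x f x<M) ⟩
      f x * g y ∎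
      where open ≡-Reasoning

    crt : ∀ (f g : ℕ → ℕ) → (∀ b → f b ≡ f (b % M)) → (∀ b → g b ≡ g (b % N)) →
          ΣN (M * N) (λ b → f b * g b) ≡ ΣN M f * ΣN N g
    crt f g pf pg = begin
      ΣN (M * N) (λ b → f b * g b)
        ≡⟨ ΣN-cong (M * N) (λ b _ → trans (cong₂ _*_ (pf b) (pg b)) (sym (δδ-sum f g (b % M) (b % N) (m%n<n b M) (m%n<n b N)))) ⟩
      ΣN (M * N) (λ b → ΣN M (λ i → ΣN N (λ j → hits i j b * (f i * g j))))
        ≡⟨ ΣN-swap (M * N) M (λ b i → ΣN N (λ j → hits i j b * (f i * g j))) ⟩
      ΣN M (λ i → ΣN (M * N) (λ b → ΣN N (λ j → hits i j b * (f i * g j))))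
        ≡⟨ ΣN-cong M (λ i _ → ΣN-swap (M * N) N (λ b j → hits i j b * (f i * g j))) ⟩
      ΣN M (λ i → ΣN N (λ j → ΣN (M * N) (λ b → hits i j b * (f i * g j))))
        ≡⟨ ΣN-cong M (λ i i<M → ΣN-cong N (λ j j<N → once i j i<M j<N)) ⟩
      ΣN M (λ i → ΣN N (λ j → f i * g j))
        ≡⟨ ΣN-cong M (λ i _ → ΣN-*ˡ N (f i) g) ⟩
      ΣN M (λ i → f i * ΣN N g)
        ≡⟨ ΣN-*ʳ M (ΣN N g) f ⟩
      ΣN M f * ΣN N g ∎
      where
      open ≡-Reasoning
      once : ∀ i j → i < M → j < N → ΣN (M * N) (λ b → hits i j b * (f i * g j)) ≡ f i * g j
      once i j i<M j<N = trans (ΣN-*ʳ (M * N) (f i * g j) (hits i j))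
                               (trans (cong (_* (f i * g j)) (count≡1 i j i<M j<N)) (*-identityˡ _))

module PrimePowers where

  open import Data.Nat
  open import Data.Nat.Properties
  open import Data.Nat.Divisibility
  open import Data.Nat.GCD
  open import Data.Nat.Primality
  open import Data.Nat.Coprimality using (Coprime; coprime-divisor)
  open import Data.Product using (_×_; _,_; Σ)
  open import Data.Sum using (inj₁; inj₂)
  open import Data.Empty using (⊥-elim)
  open import Relation.Nullary using (yes; no; ¬_)
  open import Relation.Binary.PropositionalEquality

  prime>1 : ∀ {p} → Prime p → 1 < p
  prime>1 {p} (prime _) = nonTrivial⇒n>1 p

  pow-dvd : ∀ p i j → i ≤ j → p ^ i ∣ p ^ j
  pow-dvd p i j le = divides (p ^ (j ∸ i)) (begin
    p ^ j             ≡⟨ cong (p ^_) (sym (m+[n∸m]≡n le)) ⟩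
    p ^ (i + (j ∸ i)) ≡⟨ ^-distribˡ-+-* p i (j ∸ i) ⟩
    p ^ i * p ^ (j ∸ i) ≡⟨ *-comm (p ^ i) _ ⟩
    p ^ (j ∸ i) * p ^ i ∎)
    where open ≡-Reasoning

  pow-ndvd : ∀ {p} → 1 < p → ∀ x → ¬ (p ^ suc x ∣ p ^ x)
  pow-ndvd {p} p>1 x h =
    <⇒≱ (^-monoʳ-< p p>1 (n<1+n x)) (∣⇒≤ {{>-nonZero (m^n>0 p {{>-nonZero (<-trans z<s p>1)}} x)}} h)

  powDiv : ∀ {p} → Prime p → ∀ A d → d ∣ p ^ A → Σ ℕ λ x → x ≤ A × d ≡ p ^ x
  powDiv {p} pp zero d h = 0 , z≤n , ∣1⇒≡1 h
  powDiv {p} pp (suc A) d h with p ∣? d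
  ... | yes (divides d' refl) with powDiv pp A d' (*-cancelˡ-∣ p {{prime⇒nonZero pp}} (subst (_∣ p * p ^ A) (*-comm d' p) h))
  ...   | x , x≤A , e = suc x , s≤s x≤A , trans (cong (_* p) e) (*-comm (p ^ x) p)
  powDiv {p} pp (suc A) d h | no p∤d with powDiv pp A d (coprime-divisor d⊥p h)
    where
    d⊥p : Coprime d p
    d⊥p {e} (e∣d , e∣p) with prime⇒irreducible pp e∣p
    ... | inj₁ e≡1 = e≡1
    ... | inj₂ refl = ⊥-elim (p∤d e∣d)
  ... | x , x≤A , e = x , m≤n⇒m≤1+n x≤A , e

  primeDivPow : ∀ {p r} → Prime p → Prime r → ∀ A → r ∣ p ^ A → r ≡ p
  primeDivPow {p} {r} pp pr@(prime _) zero h = ⊥-elim (nonTrivial⇒≢1 (∣1⇒≡1 h))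
  primeDivPow {p} {r} pp pr (suc A) h with euclidsLemma p (p ^ A) pr h
  ... | inj₂ h' = primeDivPow pp pr A h'
  ... | inj₁ h' with prime⇒irreducible pp h' | pr
  ...   | inj₁ refl | ()
  ...   | inj₂ r≡p  | _ = r≡p

  coprime-pows : ∀ {p q} → Prime p → Prime q → p ≢ q → ∀ A B → Coprime (p ^ A) (q ^ B)
  coprime-pows {p} {q} pp pq p≢q A B {e} (e∣P , e∣Q) with powDiv pp A e e∣P
  ... | zero , _ , e≡1 = e≡1
  ... | suc x , _ , refl = ⊥-elim (p≢q (primeDivPow pq pp B (∣-trans (m∣m*n (p ^ x)) e∣Q)))

  coprime-*ˡ : ∀ {a b c} → Coprime a c → Coprime b c → Coprime (a * b) c
  coprime-*ˡ a⊥c b⊥c (d∣ab , d∣c) = b⊥c (coprime-divisor d⊥a d∣ab , d∣c)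
    where
    d⊥a : Coprime _ _
    d⊥a (e∣d , e∣a) = a⊥c (e∣a , ∣-trans e∣d d∣c)

  gcdSplit⇒ : ∀ a X Y b → gcd a (X * Y) ∣ b → gcd a X ∣ b × gcd a Y ∣ b
  gcdSplit⇒ a X Y b h =
    ∣-trans (gcd-greatest (gcd[m,n]∣m a X) (∣-trans (gcd[m,n]∣n a X) (m∣m*n Y))) h ,
    ∣-trans (gcd-greatest (gcd[m,n]∣m a Y) (∣-trans (gcd[m,n]∣n a Y) (n∣m*n X))) h

  gcdSplit⇐ : ∀ a X Y b → Coprime X Y → gcd a X ∣ b → gcd a Y ∣ b → gcd a (X * Y) ∣ b
  gcdSplit⇐ a X Y b X⊥Y u∣b v∣b = ∣-trans g∣uv (uv∣b u∣b v∣b)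
    where
    u : ℕ
    u = gcd a X
    v : ℕ
    v = gcd a Y
    g : ℕ
    g = gcd a (X * Y)
    v⊥u : Coprime v u
    v⊥u (e∣v , e∣u) = X⊥Y (∣-trans e∣u (gcd[m,n]∣n a X) , ∣-trans e∣v (gcd[m,n]∣n a Y))
    uv∣b : ∀ {b} → u ∣ b → v ∣ b → u * v ∣ b
    uv∣b (divides k refl) v∣b =
      subst (u * v ∣_) (*-comm u k) (*-monoʳ-∣ u (coprime-divisor v⊥u (subst (v ∣_) (*-comm k u) v∣b)))
    -- g divides gcd(Ya, YX) = Y·u, and hence gcd(ua, uY) = u·v.
    g∣uY : g ∣ u * Y
    g∣uY = subst (g ∣_) (trans (sym (c*gcd[m,n]≡gcd[cm,cn] Y a X)) (*-comm Y u))
             (gcd-greatest (∣n⇒∣m*n Y (gcd[m,n]∣m a (X * Y))) (subst (g ∣_) (*-comm X Y) (gcd[m,n]∣n a (X * Y))))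
    g∣uv : g ∣ u * v
    g∣uv = subst (g ∣_) (sym (c*gcd[m,n]≡gcd[cm,cn] u a Y)) (gcd-greatest (∣n⇒∣m*n u (gcd[m,n]∣m a (X * Y))) g∣uY)

module PowerRelation where

  open import Data.Nat
  open import Data.Nat.Properties
  open import Data.Nat.Divisibility
  open import Data.Nat.DivMod
  open import Data.Nat.GCD
  open import Data.Nat.Tactic.RingSolver using (solve-∀)
  open import Data.Fin using (Fin; toℕ; fromℕ<)
  open import Data.Fin.Properties using (toℕ<n; toℕ-fromℕ<)
  open import Data.Product using (_,_)
  open import Relation.Binary.PropositionalEquality

  isPowerOf⇒ : ∀ m (a b : Fin (suc m)) → IsPowerOf b a → gcd (toℕ a) (suc m) ∣ toℕ b
  isPowerOf⇒ m a b (k , ka≡b) = subst (gcd (toℕ a) (suc m) ∣_) ka≡b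
    (%-presˡ-∣ (∣n⇒∣m*n (toℕ k) (gcd[m,n]∣m (toℕ a) (suc m))) (gcd[m,n]∣n (toℕ a) (suc m)))

  multiple⇒isPowerOf : ∀ m (a b : Fin (suc m)) (c : ℕ) → (c * toℕ a) % suc m ≡ toℕ b → IsPowerOf b a
  multiple⇒isPowerOf m a b c h =
    fromℕ< (m%n<n c n) , trans (cong (λ v → (v * toℕ a) % n) (toℕ-fromℕ< (m%n<n c n))) (trans reduce h)
    where
    n : ℕ
    n = suc m
    reduce : ((c % n) * toℕ a) % n ≡ (c * toℕ a) % n
    reduce = trans (%-distribˡ-* (c % n) (toℕ a) n)
                   (trans (cong (λ v → (v * (toℕ a % n)) % n) (m%n%n≡m%n c n)) (sym (%-distribˡ-* c (toℕ a) n)))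

  -- By Bézout, g = gcd(a, n) is a multiple of a modulo n, hence so is b = q·g.
  isPowerOf⇐ : ∀ m (a b : Fin (suc m)) → gcd (toℕ a) (suc m) ∣ toℕ b → IsPowerOf b a
  isPowerOf⇐ m a b (divides q b≡qg) with Bézout.identity (gcd-GCD (toℕ a) (suc m))
  ... | Bézout.+- x y g+yn≡xa = multiple⇒isPowerOf m a b (q * x)
    (trans (cong (_% n) shift) (trans ([m+kn]%n≡m%n (toℕ b) (q * y) n) (m<n⇒m%n≡m (toℕ<n b))))
    where
    n : ℕ
    n = suc m
    g : ℕ
    g = gcd (toℕ a) n
    shift : q * x * toℕ a ≡ toℕ b + q * y * n
    shift = begin
      q * x * toℕ a       ≡⟨ *-assoc q x (toℕ a) ⟩
      q * (x * toℕ a)     ≡⟨ cong (q *_) (sym g+yn≡xa) ⟩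
      q * (g + y * n)     ≡⟨ *-distribˡ-+ q g (y * n) ⟩
      q * g + q * (y * n) ≡⟨ cong₂ _+_ (sym b≡qg) (sym (*-assoc q y n)) ⟩
      toℕ b + q * y * n   ∎
      where open ≡-Reasoning
  ... | Bézout.-+ x y g+xa≡yn = multiple⇒isPowerOf m a b (q * (m * x))
    (trans (sym ([m+kn]%n≡m%n (q * (m * x) * A) (q * y) n))
           (trans (cong (_% n) shift) (trans ([m+kn]%n≡m%n (toℕ b) (q * (x * A)) n) (m<n⇒m%n≡m (toℕ<n b)))))
    where
    n : ℕ
    n = suc m
    g : ℕ
    g = gcd (toℕ a) n
    A : ℕ
    A = toℕ a
    -- Here g ≡ -x·a and m ≡ -1 (mod n), so q·(m·x)·a ≡ q·g = b (mod n).
    regroup : ∀ q m x A g → q * (m * x) * A + q * (g + x * A) ≡ q * g + q * (x * A) * suc m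
    regroup = solve-∀
    shift : q * (m * x) * A + q * y * n ≡ toℕ b + q * (x * A) * n
    shift = begin
      q * (m * x) * A + q * y * n       ≡⟨ cong (q * (m * x) * A +_) (*-assoc q y n) ⟩
      q * (m * x) * A + q * (y * n)     ≡⟨ cong (λ v → q * (m * x) * A + q * v) (sym g+xa≡yn) ⟩
      q * (m * x) * A + q * (g + x * A) ≡⟨ regroup q m x A g ⟩
      q * g + q * (x * A) * n           ≡⟨ cong (_+ q * (x * A) * n) (sym b≡qg) ⟩
      toℕ b + q * (x * A) * n           ∎
      where open ≡-Reasoning

-- Fix a with gcd(a, p^A) = p^x and put
-- s = A - x (so p^s is the p-part of the order of a).  Among the residues j
-- mod p^A,
--   * j lies below a  (p^x ∣ j)                          for p^s of them,
--   * j lies above a  (gcd(j, p^A) ∣ p^x)                 for p^A - p^(s-1),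
--   * j generates the same local subgroup (both)          for φ(p^s) of them,
-- with the conventions p^A and 1 for the last two when s = 0.
module LocalCounts where

  open import Data.Nat
  open import Data.Nat.Properties
  open import Data.Nat.Divisibility
  open import Data.Nat.DivMod
  open import Data.Nat.GCD
  open import Data.Nat.Primality
  open import Data.Sum using (_⊎_; inj₁; inj₂)
  open import Data.Product using (_×_; _,_)
  open import Data.Empty using (⊥-elim)
  open import Relation.Nullary using (Dec; yes; no; ¬_)
  open import Relation.Nullary.Decidable using (_⊎-dec_; ¬?; toSum)
  open import Relation.Binary.PropositionalEquality
  open Sums
  open PrimePowers

  record Counts : Set where
    constructor counts
    field
      below above gen : ℕ

  localCounts : (p A s : ℕ) → Counts
  localCounts p A zero    = counts 1 (p ^ A) 1
  localCounts p A (suc s) = counts (p ^ suc s) (p ^ A ∸ p ^ s) (p ^ suc s ∸ p ^ s)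

  -- j lies above a locally: gcd(j, p^A) ∣ p^x, in divisibility-free form.
  Above : ℕ → ℕ → ℕ → ℕ → Set
  Above p A x j = (x ≡ A) ⊎ ¬ (p ^ suc x ∣ j)

  above? : ∀ p A x j → Dec (Above p A x j)
  above? p A x j = (x ≟ A) ⊎-dec ¬? (p ^ suc x ∣? j)

  belowI : ℕ → ℕ → ℕ → ℕ
  belowI p x j = ind (p ^ x ∣? j)

  aboveI : ℕ → ℕ → ℕ → ℕ → ℕ
  aboveI p A x j = ind (above? p A x j)

  module _ {p : ℕ} (pp : Prime p) where

    above⇒ : ∀ A x j → x ≤ A → gcd j (p ^ A) ∣ p ^ x → Above p A x j
    above⇒ A x j x≤A h with x ≟ A
    ... | yes e = inj₁ e
    ... | no ne = inj₂ (λ d → pow-ndvd (prime>1 pp) x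
                         (∣-trans (gcd-greatest d (pow-dvd p (suc x) A (≤∧≢⇒< x≤A ne))) h))

    above⇐ : ∀ A x j → Above p A x j → gcd j (p ^ A) ∣ p ^ x
    above⇐ A x j (inj₁ refl) = gcd[m,n]∣n j (p ^ x)
    above⇐ A x j (inj₂ nd) with powDiv pp A (gcd j (p ^ A)) (gcd[m,n]∣n j (p ^ A))
    ... | k , k≤A , e with k ≤? x
    ...   | yes k≤x = subst (_∣ p ^ x) (sym e) (pow-dvd p k x k≤x)
    ...   | no k≰x = ⊥-elim (nd (∣-trans (pow-dvd p (suc x) k (≰⇒> k≰x)) (subst (_∣ j) e (gcd[m,n]∣m j (p ^ A)))))

  module _ {p : ℕ} (pp : Prime p) (A : ℕ) where

    instance
      pᴬ≢0 : NonZero (p ^ A)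
      pᴬ≢0 = m^n≢0 p A {{prime⇒nonZero pp}}

    belowI-mod : ∀ x → x ≤ A → ∀ j → belowI p x j ≡ belowI p x (j % p ^ A)
    belowI-mod x x≤A j = ind-iff (λ h → %-presˡ-∣ h (pow-dvd p x A x≤A)) (∣n∣m%n⇒∣m (pow-dvd p x A x≤A))
                                 (p ^ x ∣? j) (p ^ x ∣? (j % p ^ A))

    aboveI-mod : ∀ x → x ≤ A → ∀ j → aboveI p A x j ≡ aboveI p A x (j % p ^ A)
    aboveI-mod x x≤A j = ind-iff to from (above? p A x j) (above? p A x (j % p ^ A))
      where
      step∣pᴬ : x ≢ A → p ^ suc x ∣ p ^ A
      step∣pᴬ x≢A = pow-dvd p (suc x) A (≤∧≢⇒< x≤A x≢A)
      to : Above p A x j → Above p A x (j % p ^ A)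
      to (inj₁ e) = inj₁ e
      to (inj₂ nd) with x ≟ A
      ... | yes e = inj₁ e
      ... | no ne = inj₂ (λ h → nd (∣n∣m%n⇒∣m (step∣pᴬ ne) h))
      from : Above p A x (j % p ^ A) → Above p A x j
      from (inj₁ e) = inj₁ e
      from (inj₂ nd) with x ≟ A
      ... | yes e = inj₁ e
      ... | no ne = inj₂ (λ h → nd (%-presˡ-∣ h (step∣pᴬ ne)))

    multiples-count : ∀ y t → y + t ≡ A → ΣN (p ^ A) (belowI p y) ≡ p ^ t
    multiples-count y t e = subst (λ M → ΣN M (belowI p y) ≡ p ^ t) pᵗpʸ≡pᴬ
                                  (ΣN-multiples (p ^ t) (p ^ y) {{m^n≢0 p y {{prime⇒nonZero pp}}}})
      where
      pᵗpʸ≡pᴬ : p ^ t * p ^ y ≡ p ^ A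
      pᵗpʸ≡pᴬ = trans (sym (^-distribˡ-+-* p t y)) (cong (p ^_) (trans (+-comm t y) e))

    below-count : ∀ x s → x + s ≡ A → ΣN (p ^ A) (belowI p x) ≡ Counts.below (localCounts p A s)
    below-count x zero    e = multiples-count x zero e
    below-count x (suc t) e = multiples-count x (suc t) e

    -- For x < A: j is above a iff p^(x+1) ∤ j, so "above" is the complement of
    -- the multiples of p^(x+1); and those multiples are exactly the j below a
    -- that are not generators.
    module _ (x : ℕ) (x<A : x < A) where

      p^x+1∣⇒¬above : ∀ j → p ^ suc x ∣ j → ¬ Above p A x j
      p^x+1∣⇒¬above j d (inj₁ refl) = <-irrefl refl x<A
      p^x+1∣⇒¬above j d (inj₂ nd) = nd d

      above-complement : ∀ j → aboveI p A x j + belowI p (suc x) j ≡ 1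
      above-complement j with toSum (p ^ suc x ∣? j)
      ... | inj₁ d = cong₂ _+_ (ind-no (above? p A x j) (p^x+1∣⇒¬above j d)) (ind-yes (p ^ suc x ∣? j) d)
      ... | inj₂ nd = cong₂ _+_ (ind-yes (above? p A x j) (inj₂ nd)) (ind-no (p ^ suc x ∣? j) nd)

      gen-complement : ∀ j → belowI p x j * aboveI p A x j + belowI p (suc x) j ≡ belowI p x j
      gen-complement j with toSum (p ^ suc x ∣? j)
      ... | inj₁ d = begin
        belowI p x j * aboveI p A x j + belowI p (suc x) j
          ≡⟨ cong₂ (λ u v → belowI p x j * u + v) (ind-no (above? p A x j) (p^x+1∣⇒¬above j d)) (ind-yes (p ^ suc x ∣? j) d) ⟩
        belowI p x j * 0 + 1
          ≡⟨ cong (_+ 1) (*-zeroʳ (belowI p x j)) ⟩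
        1
          ≡⟨ sym (ind-yes (p ^ x ∣? j) (∣-trans (pow-dvd p x (suc x) (n≤1+n x)) d)) ⟩
        belowI p x j ∎
        where open ≡-Reasoning
      ... | inj₂ nd = begin
        belowI p x j * aboveI p A x j + belowI p (suc x) j
          ≡⟨ cong₂ (λ u v → belowI p x j * u + v) (ind-yes (above? p A x j) (inj₂ nd)) (ind-no (p ^ suc x ∣? j) nd) ⟩
        belowI p x j * 1 + 0
          ≡⟨ trans (+-identityʳ _) (*-identityʳ _) ⟩
        belowI p x j ∎
        where open ≡-Reasoning

    cancel-sum : ∀ (f g h : ℕ → ℕ) t → ΣN (p ^ A) g ≡ p ^ t →
                 (∀ j → f j + g j ≡ h j) → ΣN (p ^ A) f ≡ ΣN (p ^ A) h ∸ p ^ t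
    cancel-sum f g h t hg hfgh = begin
      ΣN (p ^ A) f                                ≡⟨ sym (m+n∸n≡m _ (p ^ t)) ⟩
      ΣN (p ^ A) f + p ^ t ∸ p ^ t                ≡⟨ cong (λ v → ΣN (p ^ A) f + v ∸ p ^ t) (sym hg) ⟩
      ΣN (p ^ A) f + ΣN (p ^ A) g ∸ p ^ t         ≡⟨ cong (_∸ p ^ t) (sym (ΣN-+ (p ^ A) f g)) ⟩
      ΣN (p ^ A) (λ j → f j + g j) ∸ p ^ t        ≡⟨ cong (_∸ p ^ t) (ΣN-cong (p ^ A) (λ j _ → hfgh j)) ⟩
      ΣN (p ^ A) h ∸ p ^ t                        ∎
      where open ≡-Reasoning

    above-count : ∀ x s → x + s ≡ A → ΣN (p ^ A) (aboveI p A x) ≡ Counts.above (localCounts p A s)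
    above-count x zero e =
      trans (ΣN-cong (p ^ A) (λ j _ → ind-yes (above? p A x j) (inj₁ (trans (sym (+-identityʳ x)) e))))
            (ΣN-ones (p ^ A))
    above-count x (suc t) e =
      trans (cancel-sum (aboveI p A x) (belowI p (suc x)) (λ _ → 1) t
                        (multiples-count (suc x) t (trans (sym (+-suc x t)) e))
                        (above-complement x (subst (x <_) e (m<m+n x z<s))))
            (cong (_∸ p ^ t) (ΣN-ones (p ^ A)))

    gen-count : ∀ x s → x + s ≡ A → ΣN (p ^ A) (λ j → belowI p x j * aboveI p A x j) ≡ Counts.gen (localCounts p A s)
    gen-count x zero e =
      trans (ΣN-cong (p ^ A) (λ j _ → trans (cong (belowI p x j *_) (ind-yes (above? p A x j) (inj₁ x≡A))) (*-identityʳ _)))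
            (multiples-count x zero e)
      where
      x≡A : x ≡ A
      x≡A = trans (sym (+-identityʳ x)) e
    gen-count x (suc t) e =
      trans (cancel-sum (λ j → belowI p x j * aboveI p A x j) (belowI p (suc x)) (belowI p x) t
                        (multiples-count (suc x) t (trans (sym (+-suc x t)) e))
                        (gen-complement x (subst (x <_) e (m<m+n x z<s))))
            (cong (_∸ p ^ t) (multiples-count x (suc t) e))

  Config : Set
  Config = Counts × Counts × Counts

  -- The configuration of an element of order p^s₁ q^s₂ r^s₃ in ℤ_{p^A q^B r^C}.
  configAt : (p q r A B C : ℕ) → ℕ → ℕ → ℕ → Config
  configAt p q r A B C s₁ s₂ s₃ = localCounts p A s₁ , localCounts q B s₂ , localCounts r C s₃

  belowPlusAbove : Config → ℕ
  belowPlusAbove (x , y , z) =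
    Counts.below x * Counts.below y * Counts.below z + Counts.above x * Counts.above y * Counts.above z

  generators : Config → ℕ
  generators (x , y , z) = Counts.gen x * Counts.gen y * Counts.gen z

module DegreeFormula where

  open import Data.Nat
  open import Data.Nat.Properties
  open import Data.Nat.Divisibility
  open import Data.Nat.DivMod
  open import Data.Nat.GCD
  open import Data.Nat.Primality
  open import Data.Nat.Coprimality using (Coprime)
  open import Data.Nat.Tactic.RingSolver using (solve-∀)
  open import Data.Fin using (Fin; toℕ; zero; suc)
  open import Data.Fin.Properties using (toℕ-injective; toℕ<n)
  open import Data.List using (length; filter; tabulate)
  open import Data.Product using (_×_; _,_; proj₂)
  open import Data.Sum using (_⊎_; inj₁; inj₂)
  open import Relation.Nullary using (Dec; yes; no; ¬_)
  open import Relation.Nullary.Decidable using (_×-dec_; _⊎-dec_; ¬?; toSum)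
  open import Relation.Unary using (Decidable)
  open import Relation.Binary.PropositionalEquality
  open import Function using (_∘_; id)
  open Sums
  open CRT using (crt)
  open PrimePowers
  open LocalCounts
  open PowerRelation

  ΣF : (n : ℕ) → (Fin n → ℕ) → ℕ
  ΣF zero f = 0
  ΣF (suc n) f = f zero + ΣF n (f ∘ suc)

  ΣF-cong : ∀ n {f g : Fin n → ℕ} → (∀ i → f i ≡ g i) → ΣF n f ≡ ΣF n g
  ΣF-cong zero h = refl
  ΣF-cong (suc n) h = cong₂ _+_ (h zero) (ΣF-cong n (h ∘ suc))

  ΣF-toℕ : ∀ n (h : ℕ → ℕ) → ΣF n (h ∘ toℕ) ≡ ΣN n h
  ΣF-toℕ zero h = refl
  ΣF-toℕ (suc n) h = cong (h 0 +_) (ΣF-toℕ n (h ∘ suc))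

  filter-length : ∀ {X : Set} {P : X → Set} (P? : Decidable P) n (g : Fin n → X) →
    length (filter P? (tabulate g)) ≡ ΣF n (λ i → ind (P? (g i)))
  filter-length P? zero g = refl
  filter-length P? (suc n) g with P? (g zero)
  ... | yes _ = cong suc (filter-length P? n (g ∘ suc))
  ... | no _ = filter-length P? n (g ∘ suc)

  periodic-lift : ∀ (F : ℕ → ℕ) M L .{{_ : NonZero M}} .{{_ : NonZero L}} →
    (∀ j → F j ≡ F (j % M)) → M ∣ L → ∀ j → F j ≡ F (j % L)
  periodic-lift F M L h M∣L j = trans (h j) (trans (cong F (sym (m∣n⇒o%n%m≡o%m M L j M∣L))) (sym (h (j % L))))

  module Primes {p q r : ℕ} (pp : Prime p) (pq : Prime q) (pr : Prime r)
                (p≢q : p ≢ q) (r≢p : r ≢ p) (r≢q : r ≢ q) (A B C : ℕ) where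

    P : ℕ
    P = p ^ A
    Q : ℕ
    Q = q ^ B
    R : ℕ
    R = r ^ C

    instance
      P≢0 : NonZero P
      P≢0 = m^n≢0 p A {{prime⇒nonZero pp}}
      Q≢0 : NonZero Q
      Q≢0 = m^n≢0 q B {{prime⇒nonZero pq}}
      R≢0 : NonZero R
      R≢0 = m^n≢0 r C {{prime⇒nonZero pr}}
      PQ≢0 : NonZero (P * Q)
      PQ≢0 = m*n≢0 P Q

    P⊥Q : Coprime P Q
    P⊥Q = coprime-pows pp pq p≢q A B

    PQ⊥R : Coprime (P * Q) R
    PQ⊥R = coprime-*ˡ (coprime-pows pp pr (r≢p ∘ sym) A C) (coprime-pows pq pr (r≢q ∘ sym) B C)

    sum3 : ∀ (F G H : ℕ → ℕ) → (∀ j → F j ≡ F (j % P)) → (∀ j → G j ≡ G (j % Q)) → (∀ j → H j ≡ H (j % R)) →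
           ΣN (P * Q * R) (λ j → F j * G j * H j) ≡ ΣN P F * ΣN Q G * ΣN R H
    sum3 F G H hF hG hH =
      trans (crt (P * Q) R PQ⊥R (λ j → F j * G j) H FG-periodic hH) (cong (_* ΣN R H) (crt P Q P⊥Q F G hF hG))
      where
      FG-periodic : ∀ j → F j * G j ≡ F (j % (P * Q)) * G (j % (P * Q))
      FG-periodic j = cong₂ _*_ (periodic-lift F P (P * Q) hF (m∣m*n Q) j) (periodic-lift G Q (P * Q) hG (n∣m*n P) j)

    module Element (ga x y z : ℕ) (x≤A : x ≤ A) (y≤B : y ≤ B) (z≤C : z ≤ C)
                   (gx : gcd ga P ≡ p ^ x) (gy : gcd ga Q ≡ q ^ y) (gz : gcd ga R ≡ r ^ z) where

      -- j lies below ga (j is a power of ga) iff gcd(ga, n) ∣ j.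
      Below : ℕ → Set
      Below j = (p ^ x ∣ j × q ^ y ∣ j) × r ^ z ∣ j

      below? : ∀ j → Dec (Below j)
      below? j = ((p ^ x ∣? j) ×-dec (q ^ y ∣? j)) ×-dec (r ^ z ∣? j)

      -- j lies above ga (ga is a power of j) iff gcd(j, n) ∣ ga.
      AboveAll : ℕ → Set
      AboveAll j = (Above p A x j × Above q B y j) × Above r C z j

      aboveAll? : ∀ j → Dec (AboveAll j)
      aboveAll? j = (above? p A x j ×-dec above? q B y j) ×-dec above? r C z j

      below⇒ : ∀ j → gcd ga (P * Q * R) ∣ j → Below j
      below⇒ j h with gcdSplit⇒ ga (P * Q) R j h
      ... | h₁₂ , h₃ with gcdSplit⇒ ga P Q j h₁₂
      ...   | h₁ , h₂ = (subst (_∣ j) gx h₁ , subst (_∣ j) gy h₂) , subst (_∣ j) gz h₃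

      below⇐ : ∀ j → Below j → gcd ga (P * Q * R) ∣ j
      below⇐ j ((h₁ , h₂) , h₃) =
        gcdSplit⇐ ga (P * Q) R j PQ⊥R
          (gcdSplit⇐ ga P Q j P⊥Q (subst (_∣ j) (sym gx) h₁) (subst (_∣ j) (sym gy) h₂))
          (subst (_∣ j) (sym gz) h₃)

      -- Locally, gcd(j, s^E) ∣ ga iff gcd(j, s^E) ∣ gcd(ga, s^E) = s^w.
      abovePiece⇒ : ∀ {s} (ps : Prime s) E w → w ≤ E → gcd ga (s ^ E) ≡ s ^ w → ∀ j → gcd j (s ^ E) ∣ ga → Above s E w j
      abovePiece⇒ {s} ps E w w≤E gw j h = above⇒ ps E w j w≤E (subst (gcd j (s ^ E) ∣_) gw (gcd-greatest h (gcd[m,n]∣n j (s ^ E))))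

      abovePiece⇐ : ∀ {s} (ps : Prime s) E w → gcd ga (s ^ E) ≡ s ^ w → ∀ j → Above s E w j → gcd j (s ^ E) ∣ ga
      abovePiece⇐ {s} ps E w gw j h = ∣-trans (subst (gcd j (s ^ E) ∣_) (sym gw) (above⇐ ps E w j h)) (gcd[m,n]∣m ga (s ^ E))

      above⇒ᵃ : ∀ j → gcd j (P * Q * R) ∣ ga → AboveAll j
      above⇒ᵃ j h with gcdSplit⇒ j (P * Q) R ga h
      ... | h₁₂ , h₃ with gcdSplit⇒ j P Q ga h₁₂
      ...   | h₁ , h₂ = (abovePiece⇒ pp A x x≤A gx j h₁ , abovePiece⇒ pq B y y≤B gy j h₂) , abovePiece⇒ pr C z z≤C gz j h₃

      above⇐ᵃ : ∀ j → AboveAll j → gcd j (P * Q * R) ∣ ga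
      above⇐ᵃ j ((h₁ , h₂) , h₃) =
        gcdSplit⇐ j (P * Q) R ga PQ⊥R
          (gcdSplit⇐ j P Q ga P⊥Q (abovePiece⇐ pp A x gx j h₁) (abovePiece⇐ pq B y gy j h₂))
          (abovePiece⇐ pr C z gz j h₃)

      hBelow hAbove hBoth hEither hAdj : ℕ → ℕ
      hBelow j = ind (below? j)
      hAbove j = ind (aboveAll? j)
      hBoth j = ind (aboveAll? j ×-dec below? j)
      hEither j = ind (aboveAll? j ⊎-dec below? j)
      hAdj j = ind (¬? (ga ≟ j) ×-dec (aboveAll? j ⊎-dec below? j))

      -- Adjacency is "either" with ga itself removed (ga lies below itself).
      hAdj+δ : ∀ j → hAdj j + δ ga j ≡ hEither j
      hAdj+δ j with toSum (ga ≟ j)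
      ... | inj₁ refl =
        trans (cong₂ _+_ (ind-no (¬? (ga ≟ ga) ×-dec (aboveAll? ga ⊎-dec below? ga)) (λ (ne , _) → ne refl))
                         (ind-yes (ga ≟ ga) refl))
              (sym (ind-yes (aboveAll? ga ⊎-dec below? ga) (inj₂ (below⇒ ga (gcd[m,n]∣m ga (P * Q * R))))))
      ... | inj₂ ne =
        trans (cong₂ _+_ (ind-iff proj₂ (ne ,_) (¬? (ga ≟ j) ×-dec (aboveAll? j ⊎-dec below? j)) (aboveAll? j ⊎-dec below? j))
                         (ind-no (ga ≟ j) ne))
              (+-identityʳ _)

      bP bQ bR aP aQ aR : ℕ → ℕ
      bP = belowI p x
      bQ = belowI q y
      bR = belowI r z
      aP = aboveI p A x
      aQ = aboveI q B y
      aR = aboveI r C z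

      hBelow≡ : ∀ j → hBelow j ≡ bP j * bQ j * bR j
      hBelow≡ j = trans (ind-× ((p ^ x ∣? j) ×-dec (q ^ y ∣? j)) (r ^ z ∣? j)) (cong (_* bR j) (ind-× (p ^ x ∣? j) (q ^ y ∣? j)))

      hAbove≡ : ∀ j → hAbove j ≡ aP j * aQ j * aR j
      hAbove≡ j = trans (ind-× (above? p A x j ×-dec above? q B y j) (above? r C z j)) (cong (_* aR j) (ind-× (above? p A x j) (above? q B y j)))

      hBoth≡ : ∀ j → hBoth j ≡ (bP j * aP j) * (bQ j * aQ j) * (bR j * aR j)
      hBoth≡ j = trans (ind-× (aboveAll? j) (below? j))
                       (trans (cong₂ _*_ (hAbove≡ j) (hBelow≡ j)) (regroup (bP j) (bQ j) (bR j) (aP j) (aQ j) (aR j)))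
        where
        regroup : ∀ b₁ b₂ b₃ a₁ a₂ a₃ → a₁ * a₂ * a₃ * (b₁ * b₂ * b₃) ≡ (b₁ * a₁) * (b₂ * a₂) * (b₃ * a₃)
        regroup = solve-∀

      config : Config
      config = configAt p q r A B C (A ∸ x) (B ∸ y) (C ∸ z)

      eP : x + (A ∸ x) ≡ A
      eP = m+[n∸m]≡n x≤A
      eQ : y + (B ∸ y) ≡ B
      eQ = m+[n∸m]≡n y≤B
      eR : z + (C ∸ z) ≡ C
      eR = m+[n∸m]≡n z≤C

      sumBelow : ΣN (P * Q * R) hBelow ≡ Counts.below (localCounts p A (A ∸ x)) * Counts.below (localCounts q B (B ∸ y)) * Counts.below (localCounts r C (C ∸ z))
      sumBelow = trans (ΣN-cong (P * Q * R) (λ j _ → hBelow≡ j))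
        (trans (sum3 bP bQ bR (belowI-mod pp A x x≤A) (belowI-mod pq B y y≤B) (belowI-mod pr C z z≤C))
               (cong₂ _*_ (cong₂ _*_ (below-count pp A x _ eP) (below-count pq B y _ eQ)) (below-count pr C z _ eR)))

      sumAbove : ΣN (P * Q * R) hAbove ≡ Counts.above (localCounts p A (A ∸ x)) * Counts.above (localCounts q B (B ∸ y)) * Counts.above (localCounts r C (C ∸ z))
      sumAbove = trans (ΣN-cong (P * Q * R) (λ j _ → hAbove≡ j))
        (trans (sum3 aP aQ aR (aboveI-mod pp A x x≤A) (aboveI-mod pq B y y≤B) (aboveI-mod pr C z z≤C))
               (cong₂ _*_ (cong₂ _*_ (above-count pp A x _ eP) (above-count pq B y _ eQ)) (above-count pr C z _ eR)))

      sumBoth : ΣN (P * Q * R) hBoth ≡ generators config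
      sumBoth = trans (ΣN-cong (P * Q * R) (λ j _ → hBoth≡ j))
        (trans (sum3 (λ j → bP j * aP j) (λ j → bQ j * aQ j) (λ j → bR j * aR j)
                     (λ j → cong₂ _*_ (belowI-mod pp A x x≤A j) (aboveI-mod pp A x x≤A j))
                     (λ j → cong₂ _*_ (belowI-mod pq B y y≤B j) (aboveI-mod pq B y y≤B j))
                     (λ j → cong₂ _*_ (belowI-mod pr C z z≤C j) (aboveI-mod pr C z z≤C j)))
               (cong₂ _*_ (cong₂ _*_ (gen-count pp A x _ eP) (gen-count pq B y _ eQ)) (gen-count pr C z _ eR)))

      adjacency-sum : ga < P * Q * R → ΣN (P * Q * R) hAdj + 1 + generators config ≡ belowPlusAbove config
      adjacency-sum ga<n = begin
        ΣN N hAdj + 1 + generators config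
          ≡⟨ cong (λ v → ΣN N hAdj + v + generators config) (sym (trans (ΣN-cong N (λ j _ → sym (*-identityʳ (δ ga j)))) (ΣN-delta N ga (λ _ → 1) ga<n))) ⟩
        ΣN N hAdj + ΣN N (δ ga) + generators config
          ≡⟨ cong₂ _+_ (sym (ΣN-+ N hAdj (δ ga))) (sym sumBoth) ⟩
        ΣN N (λ j → hAdj j + δ ga j) + ΣN N hBoth
          ≡⟨ cong (_+ ΣN N hBoth) (ΣN-cong N (λ j _ → hAdj+δ j)) ⟩
        ΣN N hEither + ΣN N hBoth
          ≡⟨ sym (ΣN-+ N hEither hBoth) ⟩
        ΣN N (λ j → hEither j + hBoth j)
          ≡⟨ ΣN-cong N (λ j _ → ind-⊎ (aboveAll? j) (below? j)) ⟩
        ΣN N (λ j → hAbove j + hBelow j)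
          ≡⟨ ΣN-+ N hAbove hBelow ⟩
        ΣN N hAbove + ΣN N hBelow
          ≡⟨ +-comm (ΣN N hAbove) (ΣN N hBelow) ⟩
        ΣN N hBelow + ΣN N hAbove
          ≡⟨ cong₂ _+_ sumBelow sumAbove ⟩
        belowPlusAbove config ∎
        where
        open ≡-Reasoning
        N : ℕ
        N = P * Q * R

    module _ (m : ℕ) (n≡PQR : suc m ≡ P * Q * R) where

      degFormula : ∀ (a : Fin (suc m)) x y z (x≤A : x ≤ A) (y≤B : y ≤ B) (z≤C : z ≤ C) →
        gcd (toℕ a) P ≡ p ^ x → gcd (toℕ a) Q ≡ q ^ y → gcd (toℕ a) R ≡ r ^ z →
        deg a + 1 + generators (configAt p q r A B C (A ∸ x) (B ∸ y) (C ∸ z)) ≡ belowPlusAbove (configAt p q r A B C (A ∸ x) (B ∸ y) (C ∸ z))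
      degFormula a x y z x≤A y≤B z≤C gx gy gz =
        trans (cong (λ v → v + 1 + generators config) deg≡) (adjacency-sum (subst (toℕ a <_) n≡PQR (toℕ<n a)))
        where
        open Element (toℕ a) x y z x≤A y≤B z≤C gx gy gz
        adjacent⇔ : ∀ b → ind (adj? a b) ≡ hAdj (toℕ b)
        adjacent⇔ b = ind-iff to from (adj? a b) (¬? (toℕ a ≟ toℕ b) ×-dec (aboveAll? (toℕ b) ⊎-dec below? (toℕ b)))
          where
          to : Adj a b → ¬ (toℕ a ≡ toℕ b) × (AboveAll (toℕ b) ⊎ Below (toℕ b))
          to (ne , inj₁ a^k≡b) = (ne ∘ toℕ-injective) , inj₁ (above⇒ᵃ (toℕ b) (subst (λ N → gcd (toℕ b) N ∣ toℕ a) n≡PQR (isPowerOf⇒ m b a a^k≡b)))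
          to (ne , inj₂ b^k≡a) = (ne ∘ toℕ-injective) , inj₂ (below⇒ (toℕ b) (subst (λ N → gcd (toℕ a) N ∣ toℕ b) n≡PQR (isPowerOf⇒ m a b b^k≡a)))
          from : ¬ (toℕ a ≡ toℕ b) × (AboveAll (toℕ b) ⊎ Below (toℕ b)) → Adj a b
          from (ne , inj₁ ab) = (ne ∘ cong toℕ) , inj₁ (isPowerOf⇐ m b a (subst (λ N → gcd (toℕ b) N ∣ toℕ a) (sym n≡PQR) (above⇐ᵃ (toℕ b) ab)))
          from (ne , inj₂ bl) = (ne ∘ cong toℕ) , inj₂ (isPowerOf⇐ m a b (subst (λ N → gcd (toℕ a) N ∣ toℕ b) (sym n≡PQR) (below⇐ (toℕ b) bl)))
        deg≡ : deg a ≡ ΣN (P * Q * R) hAdj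
        deg≡ = trans (filter-length (adj? a) (suc m) id)
                 (trans (ΣF-cong (suc m) adjacent⇔) (trans (ΣF-toℕ (suc m) hAdj) (cong (λ N → ΣN N hAdj) n≡PQR)))

-- Polynomial inequalities over ℕ by coefficient comparison: an expression is
-- normalised to a list of (monomial, coefficient) pairs; if every coefficient
-- of e is at most the matching coefficient of e', then ⟦e⟧ ≤ ⟦e'⟧ for every
-- assignment of the variables.
module Normaliser where

  open import Data.Nat
  open import Data.Nat.Properties
  open import Data.List using (List; []; _∷_)
  open import Data.Product using (_×_; _,_)
  open import Data.Bool using (Bool; true; false; _∧_; T)
  open import Relation.Binary.PropositionalEquality
  open import Algebra.Properties.CommutativeSemigroup *-commutativeSemigroup
    using () renaming (interchange to *-interchange)
  open import Algebra.Properties.CommutativeSemigroup +-commutativeSemigroup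
    using (x∙yz≈y∙xz) renaming (interchange to +-interchange)

  Env : Set
  Env = ℕ → ℕ

  -- A monomial is its list of exponents; variable i sits at position i.
  Mono : Set
  Mono = List ℕ

  mulM : Mono → Mono → Mono
  mulM [] ys = ys
  mulM (x ∷ xs) [] = x ∷ xs
  mulM (x ∷ xs) (y ∷ ys) = (x + y) ∷ mulM xs ys

  -- Value of a monomial whose first exponent belongs to variable i.
  evalM : Env → ℕ → Mono → ℕ
  evalM ρ i [] = 1
  evalM ρ i (k ∷ ks) = ρ i ^ k * evalM ρ (suc i) ks

  evalM-mul : ∀ ρ i m m' → evalM ρ i (mulM m m') ≡ evalM ρ i m * evalM ρ i m'
  evalM-mul ρ i [] m' = sym (+-identityʳ _)
  evalM-mul ρ i (x ∷ xs) [] = sym (*-identityʳ _)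
  evalM-mul ρ i (x ∷ xs) (y ∷ ys) =
    trans (cong₂ _*_ (^-distribˡ-+-* (ρ i) x y) (evalM-mul ρ (suc i) xs ys))
          (*-interchange (ρ i ^ x) (ρ i ^ y) _ _)

  data Cmp (m m' : Mono) : Set where
    lt : Cmp m m'
    gt : Cmp m m'
    eq : m ≡ m' → Cmp m m'

  cmpM : (m m' : Mono) → Cmp m m'
  cmpM [] [] = eq refl
  cmpM [] (_ ∷ _) = lt
  cmpM (_ ∷ _) [] = gt
  cmpM (x ∷ xs) (y ∷ ys) with compare x y
  ... | less _ _ = lt
  ... | greater _ _ = gt
  ... | equal _ with cmpM xs ys
  ...   | lt = lt
  ...   | gt = gt
  ...   | eq e = eq (cong (x ∷_) e)

  Poly : Set
  Poly = List (Mono × ℕ)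

  evalP : Env → Poly → ℕ
  evalP ρ [] = 0
  evalP ρ ((m , c) ∷ ps) = c * evalM ρ 0 m + evalP ρ ps

  mutual
    addP : Poly → Poly → Poly
    addP [] q = q
    addP (t ∷ p) q = insertP t p q

    insertP : Mono × ℕ → Poly → Poly → Poly
    insertP t p [] = t ∷ p
    insertP (m , c) p ((m' , c') ∷ q) = mergeP m c p m' c' q (cmpM m m')

    mergeP : (m : Mono) (c : ℕ) (p : Poly) (m' : Mono) (c' : ℕ) (q : Poly) → Cmp m m' → Poly
    mergeP m c p m' c' q lt = (m , c) ∷ addP p ((m' , c') ∷ q)
    mergeP m c p m' c' q gt = (m' , c') ∷ insertP (m , c) p q
    mergeP m c p m' c' q (eq _) = (m , c + c') ∷ addP p q

  mutual
    addP-sound : ∀ ρ p q → evalP ρ (addP p q) ≡ evalP ρ p + evalP ρ q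
    addP-sound ρ [] q = refl
    addP-sound ρ (t ∷ p) q = insertP-sound ρ t p q

    insertP-sound : ∀ ρ t p q → evalP ρ (insertP t p q) ≡ evalP ρ (t ∷ p) + evalP ρ q
    insertP-sound ρ t p [] = sym (+-identityʳ _)
    insertP-sound ρ (m , c) p ((m' , c') ∷ q) = mergeP-sound ρ m c p m' c' q (cmpM m m')

    mergeP-sound : ∀ ρ m c p m' c' q (k : Cmp m m') →
      evalP ρ (mergeP m c p m' c' q k) ≡ evalP ρ ((m , c) ∷ p) + evalP ρ ((m' , c') ∷ q)
    mergeP-sound ρ m c p m' c' q lt =
      trans (cong (c * evalM ρ 0 m +_) (addP-sound ρ p ((m' , c') ∷ q)))
            (sym (+-assoc (c * evalM ρ 0 m) _ _))
    mergeP-sound ρ m c p m' c' q gt =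
      trans (cong (c' * evalM ρ 0 m' +_) (insertP-sound ρ (m , c) p q))
            (x∙yz≈y∙xz (c' * evalM ρ 0 m') (c * evalM ρ 0 m + evalP ρ p) (evalP ρ q))
    mergeP-sound ρ m c p .m c' q (eq refl) =
      trans (cong₂ _+_ (*-distribʳ-+ (evalM ρ 0 m) c c') (addP-sound ρ p q))
            (+-interchange (c * evalM ρ 0 m) (c' * evalM ρ 0 m) (evalP ρ p) (evalP ρ q))

  scaleP : Mono → ℕ → Poly → Poly
  scaleP m c [] = []
  scaleP m c ((m' , c') ∷ q) = (mulM m m' , c * c') ∷ scaleP m c q

  scaleP-sound : ∀ ρ m c q → evalP ρ (scaleP m c q) ≡ (c * evalM ρ 0 m) * evalP ρ q
  scaleP-sound ρ m c [] = sym (*-zeroʳ (c * evalM ρ 0 m))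
  scaleP-sound ρ m c ((m' , c') ∷ q) = begin
    c * c' * evalM ρ 0 (mulM m m') + evalP ρ (scaleP m c q)
      ≡⟨ cong₂ _+_ (cong (c * c' *_) (evalM-mul ρ 0 m m')) (scaleP-sound ρ m c q) ⟩
    c * c' * (evalM ρ 0 m * evalM ρ 0 m') + (c * evalM ρ 0 m) * evalP ρ q
      ≡⟨ cong (_+ (c * evalM ρ 0 m) * evalP ρ q) (*-interchange c c' (evalM ρ 0 m) (evalM ρ 0 m')) ⟩
    (c * evalM ρ 0 m) * (c' * evalM ρ 0 m') + (c * evalM ρ 0 m) * evalP ρ q
      ≡⟨ sym (*-distribˡ-+ (c * evalM ρ 0 m) _ _) ⟩
    (c * evalM ρ 0 m) * (c' * evalM ρ 0 m' + evalP ρ q) ∎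
    where open ≡-Reasoning

  mulP : Poly → Poly → Poly
  mulP [] q = []
  mulP ((m , c) ∷ p) q = addP (scaleP m c q) (mulP p q)

  mulP-sound : ∀ ρ p q → evalP ρ (mulP p q) ≡ evalP ρ p * evalP ρ q
  mulP-sound ρ [] q = refl
  mulP-sound ρ ((m , c) ∷ p) q = begin
    evalP ρ (addP (scaleP m c q) (mulP p q))
      ≡⟨ addP-sound ρ (scaleP m c q) (mulP p q) ⟩
    evalP ρ (scaleP m c q) + evalP ρ (mulP p q)
      ≡⟨ cong₂ _+_ (scaleP-sound ρ m c q) (mulP-sound ρ p q) ⟩
    (c * evalM ρ 0 m) * evalP ρ q + evalP ρ p * evalP ρ q
      ≡⟨ sym (*-distribʳ-+ (evalP ρ q) (c * evalM ρ 0 m) (evalP ρ p)) ⟩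
    (c * evalM ρ 0 m + evalP ρ p) * evalP ρ q ∎
    where open ≡-Reasoning

  data Expr : Set where
    V : ℕ → Expr
    K : ℕ → Expr
    _⊕_ _⊗_ : Expr → Expr → Expr

  infixl 6 _⊕_
  infixl 7 _⊗_

  ⟦_⟧ : Expr → Env → ℕ
  ⟦ V i ⟧ ρ = ρ i
  ⟦ K k ⟧ ρ = k
  ⟦ e ⊕ e' ⟧ ρ = ⟦ e ⟧ ρ + ⟦ e' ⟧ ρ
  ⟦ e ⊗ e' ⟧ ρ = ⟦ e ⟧ ρ * ⟦ e' ⟧ ρ

  unitM : ℕ → Mono
  unitM zero = 1 ∷ []
  unitM (suc i) = 0 ∷ unitM i

  evalM-unit : ∀ ρ j i → evalM ρ j (unitM i) ≡ ρ (j + i)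
  evalM-unit ρ j zero = trans (*-identityʳ _) (trans (*-identityʳ _) (cong ρ (sym (+-identityʳ j))))
  evalM-unit ρ j (suc i) = trans (+-identityʳ _) (trans (evalM-unit ρ (suc j) i) (cong ρ (sym (+-suc j i))))

  norm : Expr → Poly
  norm (V i) = (unitM i , 1) ∷ []
  norm (K k) = ([] , k) ∷ []
  norm (e ⊕ e') = addP (norm e) (norm e')
  norm (e ⊗ e') = mulP (norm e) (norm e')

  norm-sound : ∀ ρ e → evalP ρ (norm e) ≡ ⟦ e ⟧ ρ
  norm-sound ρ (V i) = trans (+-identityʳ _) (trans (+-identityʳ _) (evalM-unit ρ 0 i))
  norm-sound ρ (K k) = trans (+-identityʳ _) (*-identityʳ k)
  norm-sound ρ (e ⊕ e') = trans (addP-sound ρ (norm e) (norm e')) (cong₂ _+_ (norm-sound ρ e) (norm-sound ρ e'))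
  norm-sound ρ (e ⊗ e') = trans (mulP-sound ρ (norm e) (norm e')) (cong₂ _*_ (norm-sound ρ e) (norm-sound ρ e'))

  dominates : Poly → Poly → Bool
  dominates p [] = true
  dominates [] (_ ∷ _) = false
  dominates ((m , c) ∷ p) ((m' , c') ∷ q) with cmpM m m'
  ... | lt = dominates p ((m' , c') ∷ q)
  ... | gt = false
  ... | eq _ = (c' ≤ᵇ c) ∧ dominates p q

  dominates-sound : ∀ ρ p q → T (dominates p q) → evalP ρ q ≤ evalP ρ p
  dominates-sound ρ p [] h = z≤n
  dominates-sound ρ ((m , c) ∷ p) ((m' , c') ∷ q) h with cmpM m m'
  ... | lt = ≤-trans (dominates-sound ρ p ((m' , c') ∷ q) h) (m≤n+m (evalP ρ p) (c * evalM ρ 0 m))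
  dominates-sound ρ ((m , c) ∷ p) ((m' , c') ∷ q) h | eq refl with c' ≤ᵇ c in e₁
  ... | true = +-mono-≤ (*-monoˡ-≤ (evalM ρ 0 m) (≤ᵇ⇒≤ c' c (subst T (sym e₁) _)))
                        (dominates-sound ρ p q h)

  ≤-byCoefficients : ∀ ρ e e' → T (dominates (norm e') (norm e)) → ⟦ e ⟧ ρ ≤ ⟦ e' ⟧ ρ
  ≤-byCoefficients ρ e e' h =
    subst₂ _≤_ (norm-sound ρ e) (norm-sound ρ e') (dominates-sound ρ (norm e') (norm e) h)

-- For configurations c, t write
--     c ≽ t  :⇔  belowPlusAbove t + generators c ≤ belowPlusAbove c + generators t,
-- so that c ≽ t means deg(c) ≥ deg(t) for elements with these configurations.
module DegreeComparison where

  open import Data.Nat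
  open import Data.Nat.Properties
  open import Data.Nat.Tactic.RingSolver using (solve-∀)
  open import Data.Bool using (Bool; T; _∧_; _∨_)
  open import Data.Bool.Properties using (T-∧; T-∨)
  open import Data.Product using (_×_; _,_; Σ)
  open import Data.Sum using (_⊎_; inj₁; inj₂)
  open import Data.Unit using (tt)
  open import Function using (_∘_; Equivalence)
  open import Relation.Nullary using (yes; no)
  open import Relation.Binary.PropositionalEquality
  open Normaliser using (Env; Expr; V; K; _⊕_; _⊗_; ⟦_⟧; norm; dominates; ≤-byCoefficients)
  open LocalCounts using (Counts; counts; Config; belowPlusAbove; generators; localCounts; configAt)

  infix 4 _≽_
  _≽_ : Config → Config → Set
  c ≽ t = belowPlusAbove t + generators c ≤ belowPlusAbove c + generators t

  ≽-trans : ∀ {c c' t} → c ≽ c' → c' ≽ t → c ≽ t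
  ≽-trans {c} {c'} {t} h₁ h₂ =
    +-cancelʳ-≤ (belowPlusAbove c' + generators c') (belowPlusAbove t + generators c) (belowPlusAbove c + generators t)
      (subst₂ _≤_ (regroup₁ (generators c) (belowPlusAbove c') (generators c') (belowPlusAbove t))
                  (regroup₂ (belowPlusAbove c) (belowPlusAbove c') (generators c') (generators t))
                  (+-mono-≤ h₁ h₂))
    where
    regroup₁ : ∀ g₁ s₂ g₂ s₃ → (s₂ + g₁) + (s₃ + g₂) ≡ (s₃ + g₁) + (s₂ + g₂)
    regroup₁ = solve-∀
    regroup₂ : ∀ s₁ s₂ g₂ g₃ → (s₁ + g₂) + (s₂ + g₃) ≡ (s₁ + g₃) + (s₂ + g₂)
    regroup₂ = solve-∀

  ≽⇒deg-≥ : ∀ c t dc dt → dc + 1 + generators c ≡ belowPlusAbove c → dt + 1 + generators t ≡ belowPlusAbove t →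
           c ≽ t → dt ≤ dc
  ≽⇒deg-≥ c t dc dt = compareDegrees (generators c) (generators t) (belowPlusAbove c) (belowPlusAbove t)
    where
    regroup : ∀ d g g' → d + 1 + g + g' ≡ d + (1 + g + g')
    regroup = solve-∀
    swap : ∀ d g g' → d + 1 + g + g' ≡ d + (1 + g' + g)
    swap = solve-∀
    compareDegrees : ∀ gc gt sc st → dc + 1 + gc ≡ sc → dt + 1 + gt ≡ st → st + gc ≤ sc + gt → dt ≤ dc
    compareDegrees gc gt _ _ refl refl le =
      +-cancelʳ-≤ (1 + gc + gt) dt dc (subst₂ _≤_ (swap dt gt gc) (regroup dc gc gt) le)

  -- Shapes of local counts for a prime p = 2 + x with D = p^(A-1) - 1:
  -- level0 is the case s = 0; levelS x u w is the case s ≥ 1 with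
  -- p^(s-1) = 1 + u and u + w = D; level1 and levelTop are s = 1 and s = A.
  level0 : ℕ → ℕ → Counts
  level0 x D = counts 1 ((2 + x) * (1 + D)) 1

  levelS : ℕ → ℕ → ℕ → Counts
  levelS x u w = counts ((2 + x) * (1 + u)) ((1 + x) * (1 + u) + (2 + x) * w) ((1 + x) * (1 + u))

  level1 levelTop : ℕ → ℕ → Counts
  level1 x D = levelS x 0 D
  levelTop x D = levelS x D 0

  Shape : ℕ → ℕ → Counts → Set
  Shape x D T = T ≡ level0 x D ⊎ Σ ℕ λ u → Σ ℕ λ w → (u + w ≡ D) × (T ≡ levelS x u w)

  -- Reduction to extremal shapes: with the other two coordinates fixed, both
  -- quantities are affine in u along u + w = D, so one of the endpoints
  -- u = 0, w = 0 has degree at most that of levelS x u w.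
  ≤-from-surplus : ∀ L R m y k → L + m * (y + k) ≡ R + m * y → L ≤ R
  ≤-from-surplus L R m y k balance = m+n≤o⇒m≤o L (≤-reflexive (+-cancelʳ-≡ (m * y) (L + m * k) R (begin
    L + m * k + m * y   ≡⟨ +-assoc L (m * k) (m * y) ⟩
    L + (m * k + m * y) ≡⟨ cong (L +_) (trans (+-comm (m * k) (m * y)) (sym (*-distribˡ-+ m y k))) ⟩
    L + m * (y + k)     ≡⟨ balance ⟩
    R + m * y           ∎)))
    where open ≡-Reasoning

  slide-left : ∀ a u w uy ly by uz lz bz →
    ((2 + a) * (1 + 0) * uy * uz + ((1 + a) * (1 + 0) + (2 + a) * (u + w)) * ly * lz) + (1 + a) * (1 + u) * by * bz + u * ((2 + a) * (uy * uz))
    ≡ ((2 + a) * (1 + u) * uy * uz + ((1 + a) * (1 + u) + (2 + a) * w) * ly * lz) + (1 + a) * (1 + 0) * by * bz + u * (ly * lz + (1 + a) * (by * bz))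
  slide-left = solve-∀

  slide-right : ∀ a u w uy ly by uz lz bz →
    ((2 + a) * (1 + (u + w)) * uy * uz + ((1 + a) * (1 + (u + w)) + (2 + a) * 0) * ly * lz) + (1 + a) * (1 + u) * by * bz + w * (ly * lz + (1 + a) * (by * bz))
    ≡ ((2 + a) * (1 + u) * uy * uz + ((1 + a) * (1 + u) + (2 + a) * w) * ly * lz) + (1 + a) * (1 + (u + w)) * by * bz + w * ((2 + a) * (uy * uz))
  slide-right = solve-∀

  ≽-by-slope : ∀ c t m M N → M ≤ N →
    belowPlusAbove t + generators c + m * N ≡ belowPlusAbove c + generators t + m * M → c ≽ t
  ≽-by-slope c t m M N M≤N balance = ≤-from-surplus _ _ m M (N ∸ M)
    (subst (λ v → belowPlusAbove t + generators c + m * v ≡ belowPlusAbove c + generators t + m * M)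
           (sym (m+[n∸m]≡n M≤N)) balance)

  endpoint : ∀ a u w y z →
    (levelS a u w , y , z) ≽ (levelS a 0 (u + w) , y , z) ⊎ (levelS a u w , y , z) ≽ (levelS a (u + w) 0 , y , z)
  endpoint a u w y@(counts uy ly by) z@(counts uz lz bz) with (ly * lz + (1 + a) * (by * bz)) ≤? ((2 + a) * (uy * uz))
  ... | yes M≤N = inj₁ (≽-by-slope (levelS a u w , y , z) (levelS a 0 (u + w) , y , z) u _ _ M≤N (slide-left a u w uy ly by uz lz bz))
  ... | no M≰N = inj₂ (≽-by-slope (levelS a u w , y , z) (levelS a (u + w) 0 , y , z) w _ _ (<⇒≤ (≰⇒> M≰N)) (slide-right a u w uy ly by uz lz bz))

  UpClosed : (Config → Set) → Set
  UpClosed Ψ = ∀ c c' → c ≽ c' → Ψ c' → Ψ c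

  reduce₁ : (Ψ : Config → Set) → UpClosed Ψ → ∀ x D T y z → Shape x D T →
    Ψ (level0 x D , y , z) → Ψ (level1 x D , y , z) → Ψ (levelTop x D , y , z) → Ψ (T , y , z)
  reduce₁ Ψ up x D T y z (inj₁ refl) h₀ h₁ hTop = h₀
  reduce₁ Ψ up x D T y z (inj₂ (u , w , refl , refl)) h₀ h₁ hTop with endpoint x u w y z
  ... | inj₁ le = up _ _ le h₁
  ... | inj₂ le = up _ _ le hTop

  swap₁₂ swap₁₃ : Config → Config
  swap₁₂ (x , y , z) = (y , x , z)
  swap₁₃ (x , y , z) = (z , y , x)

  swap₁₂-≽ : ∀ c t → c ≽ t → swap₁₂ c ≽ swap₁₂ t
  swap₁₂-≽ (counts a₁ b₁ c₁ , counts a₂ b₂ c₂ , counts a₃ b₃ c₃) (counts d₁ e₁ f₁ , counts d₂ e₂ f₂ , counts d₃ e₃ f₃) =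
    subst₂ _≤_ (perm d₁ e₁ f₁ d₂ e₂ f₂ d₃ e₃ c₁ c₂ c₃) (perm a₁ b₁ c₁ a₂ b₂ c₂ a₃ b₃ f₁ f₂ f₃)
    where
    perm : ∀ u₁ l₁ g₁ u₂ l₂ g₂ u₃ l₃ h₁ h₂ h₃ →
      u₁ * u₂ * u₃ + l₁ * l₂ * l₃ + h₁ * h₂ * h₃ ≡ u₂ * u₁ * u₃ + l₂ * l₁ * l₃ + h₂ * h₁ * h₃
    perm = solve-∀

  swap₁₃-≽ : ∀ c t → c ≽ t → swap₁₃ c ≽ swap₁₃ t
  swap₁₃-≽ (counts a₁ b₁ c₁ , counts a₂ b₂ c₂ , counts a₃ b₃ c₃) (counts d₁ e₁ f₁ , counts d₂ e₂ f₂ , counts d₃ e₃ f₃) =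
    subst₂ _≤_ (perm d₁ e₁ f₁ d₂ e₂ f₂ d₃ e₃ c₁ c₂ c₃) (perm a₁ b₁ c₁ a₂ b₂ c₂ a₃ b₃ f₁ f₂ f₃)
    where
    perm : ∀ u₁ l₁ g₁ u₂ l₂ g₂ u₃ l₃ h₁ h₂ h₃ →
      u₁ * u₂ * u₃ + l₁ * l₂ * l₃ + h₁ * h₂ * h₃ ≡ u₃ * u₂ * u₁ + l₃ * l₂ * l₁ + h₃ * h₂ * h₁
    perm = solve-∀

  reduce₂ : (Ψ : Config → Set) → UpClosed Ψ → ∀ x D X T z → Shape x D T →
    Ψ (X , level0 x D , z) → Ψ (X , level1 x D , z) → Ψ (X , levelTop x D , z) → Ψ (X , T , z)
  reduce₂ Ψ up x D X T z =
    reduce₁ (Ψ ∘ swap₁₂) (λ c c' le → up _ _ (swap₁₂-≽ c c' le)) x D T X z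

  reduce₃ : (Ψ : Config → Set) → UpClosed Ψ → ∀ x D X Y T → Shape x D T →
    Ψ (X , Y , level0 x D) → Ψ (X , Y , level1 x D) → Ψ (X , Y , levelTop x D) → Ψ (X , Y , T)
  reduce₃ Ψ up x D X Y T =
    reduce₁ (Ψ ∘ swap₁₃) (λ c c' le → up _ _ (swap₁₃-≽ c c' le)) x D T Y X

  -- The three extremal shapes, and the two target configurations: v₂ has
  -- order exponents (A, 0, C) and v₃ has (A, B, 0).  The primes are written
  -- p = 2 + a, q = 2 + (1 + a + b), r = 2 + (2 + a + b + c), so that p < q < r.
  data Kind : Set where
    bottom one top : Kind

  levelOf : Kind → ℕ → ℕ → Counts
  levelOf bottom = level0
  levelOf one    = level1
  levelOf top    = levelTop

  v₂Config v₃Config : (a b c d e f : ℕ) → Config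
  v₂Config a b c d e f = (levelTop a d , level0 (1 + a + b) e , levelTop (2 + a + b + c) f)
  v₃Config a b c d e f = (levelTop a d , levelTop (1 + a + b) e , level0 (2 + a + b + c) f)

  Good : (a b c d e f : ℕ) → Config → Set
  Good a b c d e f cfg = cfg ≽ v₂Config a b c d e f ⊎ cfg ≽ v₃Config a b c d e f

  Good-up : ∀ a b c d e f → UpClosed (Good a b c d e f)
  Good-up a b c d e f cfg cfg' le (inj₁ h) = inj₁ (≽-trans {cfg} {cfg'} {v₂Config a b c d e f} le h)
  Good-up a b c d e f cfg cfg' le (inj₂ h) = inj₂ (≽-trans {cfg} {cfg'} {v₃Config a b c d e f} le h)

  record CountsE : Set where
    constructor countsE
    field
      belowE aboveE genE : Expr

  ConfigE : Set
  ConfigE = CountsE × CountsE × CountsE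

  ⟦_⟧C : CountsE → Env → Counts
  ⟦ countsE u l g ⟧C ρ = counts (⟦ u ⟧ ρ) (⟦ l ⟧ ρ) (⟦ g ⟧ ρ)

  ⟦_⟧ᶜ : ConfigE → Env → Config
  ⟦ x , y , z ⟧ᶜ ρ = ⟦ x ⟧C ρ , ⟦ y ⟧C ρ , ⟦ z ⟧C ρ

  belowPlusAboveE generatorsE : ConfigE → Expr
  belowPlusAboveE (countsE u₁ l₁ _ , countsE u₂ l₂ _ , countsE u₃ l₃ _) = u₁ ⊗ u₂ ⊗ u₃ ⊕ l₁ ⊗ l₂ ⊗ l₃
  generatorsE (countsE _ _ g₁ , countsE _ _ g₂ , countsE _ _ g₃) = g₁ ⊗ g₂ ⊗ g₃

  dominatesᶜ : ConfigE → ConfigE → Bool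
  dominatesᶜ C C' = dominates (norm (belowPlusAboveE C ⊕ generatorsE C')) (norm (belowPlusAboveE C' ⊕ generatorsE C))

  dominatesᶜ-sound : ∀ ρ C C' → T (dominatesᶜ C C') → ⟦ C ⟧ᶜ ρ ≽ ⟦ C' ⟧ᶜ ρ
  dominatesᶜ-sound ρ C@(countsE _ _ _ , countsE _ _ _ , countsE _ _ _) C'@(countsE _ _ _ , countsE _ _ _ , countsE _ _ _) =
    ≤-byCoefficients ρ (belowPlusAboveE C' ⊕ generatorsE C) (belowPlusAboveE C ⊕ generatorsE C')

  level0E levelTopE level1E : Expr → Expr → CountsE
  level0E x D = countsE (K 1) ((K 2 ⊕ x) ⊗ (K 1 ⊕ D)) (K 1)
  levelTopE x D = countsE ((K 2 ⊕ x) ⊗ (K 1 ⊕ D)) ((K 1 ⊕ x) ⊗ (K 1 ⊕ D) ⊕ (K 2 ⊕ x) ⊗ K 0) ((K 1 ⊕ x) ⊗ (K 1 ⊕ D))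
  level1E x D = countsE ((K 2 ⊕ x) ⊗ (K 1 ⊕ K 0)) ((K 1 ⊕ x) ⊗ (K 1 ⊕ K 0) ⊕ (K 2 ⊕ x) ⊗ D) ((K 1 ⊕ x) ⊗ (K 1 ⊕ K 0))

  levelOfE : Kind → Expr → Expr → CountsE
  levelOfE bottom = level0E
  levelOfE one    = level1E
  levelOfE top    = levelTopE

  ⟦levelOfE⟧ : ∀ ρ k x D → ⟦ levelOfE k x D ⟧C ρ ≡ levelOf k (⟦ x ⟧ ρ) (⟦ D ⟧ ρ)
  ⟦levelOfE⟧ ρ bottom x D = refl
  ⟦levelOfE⟧ ρ one    x D = refl
  ⟦levelOfE⟧ ρ top    x D = refl

  env : (a b c d e f : ℕ) → Env
  env a b c d e f 0 = a
  env a b c d e f 1 = b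
  env a b c d e f 2 = c
  env a b c d e f 3 = d
  env a b c d e f 4 = e
  env a b c d e f _ = f

  cornerE : Expr → Expr → Kind → Kind → Kind → ConfigE
  cornerE D F i j k = levelOfE i (V 0) D , levelOfE j (K 1 ⊕ V 0 ⊕ V 1) (V 4) , levelOfE k (K 2 ⊕ V 0 ⊕ V 1 ⊕ V 2) F

  goodCorner : Expr → Expr → Kind → Kind → Kind → Bool
  goodCorner D F i j k = dominatesᶜ (cornerE D F i j k) (cornerE D F top bottom top)
                       ∨ dominatesᶜ (cornerE D F i j k) (cornerE D F top top bottom)

  all3 : (Kind → Bool) → Bool
  all3 P = P bottom ∧ P one ∧ P top

  all3-sound : ∀ P → T (all3 P) → ∀ k → T (P k)
  all3-sound P h k with Equivalence.to (T-∧ {P bottom}) h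
  ... | h₀ , h₁₂ with Equivalence.to (T-∧ {P one}) h₁₂
  ...   | h₁ , h₂ = pick k
    where
    pick : ∀ k → T (P k)
    pick bottom = h₀
    pick one    = h₁
    pick top    = h₂

  allCorners : Expr → Expr → Bool
  allCorners D F = all3 λ i → all3 λ j → all3 λ k → goodCorner D F i j k

  allCorners-sound : ∀ a b c d e f D F → T (allCorners D F) → ∀ i j k →
    let ρ = env a b c d e f in
    Good a b c (⟦ D ⟧ ρ) e (⟦ F ⟧ ρ) (levelOf i a (⟦ D ⟧ ρ) , levelOf j (1 + a + b) e , levelOf k (2 + a + b + c) (⟦ F ⟧ ρ))
  allCorners-sound a b c d e f D F h i j k
    rewrite sym (⟦levelOfE⟧ (env a b c d e f) i (V 0) D)
          | sym (⟦levelOfE⟧ (env a b c d e f) j (K 1 ⊕ V 0 ⊕ V 1) (V 4))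
          | sym (⟦levelOfE⟧ (env a b c d e f) k (K 2 ⊕ V 0 ⊕ V 1 ⊕ V 2) F)
    with Equivalence.to T-∨ (all3-sound (goodCorner D F i j)
                               (all3-sound (λ j → all3 (goodCorner D F i j))
                                 (all3-sound (λ i → all3 λ j → all3 (goodCorner D F i j)) h i) j) k)
  ... | inj₁ h₂ = inj₁ (dominatesᶜ-sound (env a b c d e f) (cornerE D F i j k) (cornerE D F top bottom top) h₂)
  ... | inj₂ h₃ = inj₂ (dominatesᶜ-sound (env a b c d e f) (cornerE D F i j k) (cornerE D F top top bottom) h₃)

  -- The local parameter D = p^(A-1) - 1 is 0 (A = 1) or at least p - 1.
  ZeroOrAtLeast : ℕ → ℕ → Set
  ZeroOrAtLeast m d = d ≡ 0 ⊎ Σ ℕ λ d' → d ≡ m + d'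

  -- Some corners (such
  -- as (1, 0, 1)) need the size information on D and F, so the check is
  -- run in each of the four cases for these two parameters.
  corner : ∀ a b c d e f → ZeroOrAtLeast (1 + a) d → ZeroOrAtLeast (3 + a + b + c) f → ∀ i j k →
    Good a b c d e f (levelOf i a d , levelOf j (1 + a + b) e , levelOf k (2 + a + b + c) f)
  corner a b c _ e _ (inj₁ refl) (inj₁ refl) =
    allCorners-sound a b c 0 e 0 (K 0) (K 0) tt
  corner a b c _ e _ (inj₁ refl) (inj₂ (f , refl)) =
    allCorners-sound a b c 0 e f (K 0) (K 3 ⊕ V 0 ⊕ V 1 ⊕ V 2 ⊕ V 5) tt
  corner a b c _ e _ (inj₂ (d , refl)) (inj₁ refl) =
    allCorners-sound a b c d e 0 (K 1 ⊕ V 0 ⊕ V 3) (K 0) tt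
  corner a b c _ e _ (inj₂ (d , refl)) (inj₂ (f , refl)) =
    allCorners-sound a b c d e f (K 1 ⊕ V 0 ⊕ V 3) (K 3 ⊕ V 0 ⊕ V 1 ⊕ V 2 ⊕ V 5) tt

  allShapesGood : ∀ a b c d e f → ZeroOrAtLeast (1 + a) d → ZeroOrAtLeast (3 + a + b + c) f → ∀ X Y Z →
    Shape a d X → Shape (1 + a + b) e Y → Shape (2 + a + b + c) f Z → Good a b c d e f (X , Y , Z)
  allShapesGood a b c d e f hd hf X Y Z sX sY sZ =
    reduce₃ Ψ up (2 + a + b + c) f X Y Z sZ (firstTwo bottom) (firstTwo one) (firstTwo top)
    where
    Ψ : Config → Set
    Ψ = Good a b c d e f
    up : UpClosed Ψ
    up = Good-up a b c d e f
    firstOne : ∀ j k → Ψ (X , levelOf j (1 + a + b) e , levelOf k (2 + a + b + c) f)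
    firstOne j k = reduce₁ Ψ up a d X _ _ sX (corner a b c d e f hd hf bottom j k)
                                              (corner a b c d e f hd hf one j k)
                                              (corner a b c d e f hd hf top j k)
    firstTwo : ∀ k → Ψ (X , Y , levelOf k (2 + a + b + c) f)
    firstTwo k = reduce₂ Ψ up (1 + a + b) e X Y _ sY (firstOne bottom k) (firstOne one k) (firstOne top k)

  counts-cong : ∀ {u u' l l' g g'} → u ≡ u' → l ≡ l' → g ≡ g' → counts u l g ≡ counts u' l' g'
  counts-cong refl refl refl = refl

  localCounts-levelS : ∀ a A' s → s ≤ A' →
    localCounts (2 + a) (suc A') (suc s) ≡ levelS a ((2 + a) ^ s ∸ 1) ((2 + a) ^ A' ∸ (2 + a) ^ s)
  localCounts-levelS a A' s s≤A' = fields _ _ pˢ≡1+u pᴬ'≡pˢ+w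
    where
    p : ℕ
    p = 2 + a
    pˢ≡1+u : p ^ s ≡ 1 + (p ^ s ∸ 1)
    pˢ≡1+u = sym (m+[n∸m]≡n (m^n>0 p s))
    pᴬ'≡pˢ+w : p ^ A' ≡ p ^ s + (p ^ A' ∸ p ^ s)
    pᴬ'≡pˢ+w = sym (m+[n∸m]≡n (^-monoʳ-≤ p s≤A'))
    expand : ∀ a u w → (2 + a) * ((1 + u) + w) ≡ (1 + u) + ((1 + a) * (1 + u) + (2 + a) * w)
    expand = solve-∀
    fields : ∀ u w → p ^ s ≡ 1 + u → p ^ A' ≡ p ^ s + w → localCounts p (suc A') (suc s) ≡ levelS a u w
    fields u w e₁ e₂ = counts-cong
      (cong (p *_) e₁)
      (trans (cong₂ (λ X Y → p * X ∸ Y) (trans e₂ (cong (_+ w) e₁)) e₁)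
             (trans (cong (_∸ (1 + u)) (expand a u w)) (m+n∸m≡n (1 + u) _)))
      (trans (cong (λ t → p * t ∸ t) e₁) (m+n∸m≡n (1 + u) ((1 + a) * (1 + u))))

  localCounts-level0 : ∀ a A' → localCounts (2 + a) (suc A') 0 ≡ level0 a ((2 + a) ^ A' ∸ 1)
  localCounts-level0 a A' = cong (λ v → counts 1 ((2 + a) * v) 1) (sym (m+[n∸m]≡n (m^n>0 (2 + a) A')))

  localCounts-levelTop : ∀ a A' → localCounts (2 + a) (suc A') (suc A') ≡ levelTop a ((2 + a) ^ A' ∸ 1)
  localCounts-levelTop a A' =
    trans (localCounts-levelS a A' A' ≤-refl) (cong (levelS a ((2 + a) ^ A' ∸ 1)) (n∸n≡0 ((2 + a) ^ A')))

  localCounts-shape : ∀ a A' s → s ≤ suc A' → Shape a ((2 + a) ^ A' ∸ 1) (localCounts (2 + a) (suc A') s)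
  localCounts-shape a A' zero _ = inj₁ (localCounts-level0 a A')
  localCounts-shape a A' (suc s) (s≤s s≤A') = inj₂ (_ , _ , u+w≡D , localCounts-levelS a A' s s≤A')
    where
    p : ℕ
    p = 2 + a
    u+w≡D : (p ^ s ∸ 1) + (p ^ A' ∸ p ^ s) ≡ p ^ A' ∸ 1
    u+w≡D = trans (sym (+-∸-comm (p ^ A' ∸ p ^ s) (m^n>0 p s))) (cong (_∸ 1) (m+[n∸m]≡n (^-monoʳ-≤ p s≤A')))

  pow-1-split : ∀ m p' A' → m ≤ suc p' → ZeroOrAtLeast m (suc (suc p') ^ A' ∸ 1)
  pow-1-split m p' zero _ = inj₁ refl
  pow-1-split m p' (suc A'') m≤p-1 = inj₂ (_ , sym (m+[n∸m]≡n m≤pᴬ-1))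
    where
    p : ℕ
    p = suc (suc p')
    m≤pᴬ-1 : m ≤ p * p ^ A'' ∸ 1
    m≤pᴬ-1 = m+n≤o⇒m≤o∸n m (≤-trans (subst (_≤ p) (+-comm 1 m) (s≤s m≤p-1))
                                     (subst (_≤ p * p ^ A'') (*-identityʳ p) (*-monoʳ-≤ p (m^n>0 p A''))))

  DominatedByTargets : (p q r A B C : ℕ) → Set
  DominatedByTargets p q r A B C = ∀ s₁ s₂ s₃ → s₁ ≤ A → s₂ ≤ B → s₃ ≤ C →
    configAt p q r A B C s₁ s₂ s₃ ≽ configAt p q r A B C A 0 C
    ⊎ configAt p q r A B C s₁ s₂ s₃ ≽ configAt p q r A B C A B 0

  dominance-normalised : ∀ a b c A' B' C' →
    DominatedByTargets (2 + a) (2 + (1 + a + b)) (2 + (2 + a + b + c)) (suc A') (suc B') (suc C')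
  dominance-normalised a b c A' B' C' s₁ s₂ s₃ s₁≤A s₂≤B s₃≤C
    with allShapesGood a b c _ _ _ (pow-1-split (1 + a) a A' ≤-refl)
                                   (pow-1-split (3 + a + b + c) (2 + a + b + c) C' ≤-refl)
                       _ _ _ (localCounts-shape a A' s₁ s₁≤A)
                             (localCounts-shape (1 + a + b) B' s₂ s₂≤B)
                             (localCounts-shape (2 + a + b + c) C' s₃ s₃≤C)
  ... | inj₁ h = inj₁ (subst (cfg s₁ s₂ s₃ ≽_) (sym v₂≡) h)
    where
    cfg : ℕ → ℕ → ℕ → Config
    cfg = configAt (2 + a) (2 + (1 + a + b)) (2 + (2 + a + b + c)) (suc A') (suc B') (suc C')
    v₂≡ : cfg (suc A') 0 (suc C') ≡ v₂Config a b c _ _ _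
    v₂≡ = cong₂ _,_ (localCounts-levelTop a A') (cong₂ _,_ (localCounts-level0 (1 + a + b) B') (localCounts-levelTop (2 + a + b + c) C'))
  ... | inj₂ h = inj₂ (subst (cfg s₁ s₂ s₃ ≽_) (sym v₃≡) h)
    where
    cfg : ℕ → ℕ → ℕ → Config
    cfg = configAt (2 + a) (2 + (1 + a + b)) (2 + (2 + a + b + c)) (suc A') (suc B') (suc C')
    v₃≡ : cfg (suc A') (suc B') 0 ≡ v₃Config a b c _ _ _
    v₃≡ = cong₂ _,_ (localCounts-levelTop a A') (cong₂ _,_ (localCounts-levelTop (1 + a + b) B') (localCounts-level0 (2 + a + b + c) C'))

  dominance : ∀ {p q r} → 1 < p → p < q → q < r → ∀ {A B C} → 0 < A → 0 < B → 0 < C → DominatedByTargets p q r A B C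
  dominance {p} {q} {r} 1<p p<q q<r = at (p ∸ 2) (q ∸ suc p) (r ∸ suc q) p≡ q≡ r≡
    where
    at : ∀ a b c → p ≡ 2 + a → q ≡ 2 + (1 + a + b) → r ≡ 2 + (2 + a + b + c) →
         ∀ {A B C} → 0 < A → 0 < B → 0 < C → DominatedByTargets p q r A B C
    at a b c refl refl refl {suc A'} {suc B'} {suc C'} _ _ _ = dominance-normalised a b c A' B' C'
    p≡ : p ≡ 2 + (p ∸ 2)
    p≡ = sym (m+[n∸m]≡n 1<p)
    q≡ : q ≡ 2 + (1 + (p ∸ 2) + (q ∸ suc p))
    q≡ = trans (sym (m+[n∸m]≡n p<q)) (cong (λ v → suc v + (q ∸ suc p)) p≡)
    r≡ : r ≡ 2 + (2 + (p ∸ 2) + (q ∸ suc p) + (r ∸ suc q))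
    r≡ = trans (sym (m+[n∸m]≡n q<r)) (cong (λ v → suc v + (r ∸ suc q)) q≡)

module MinimumDegree {p q r A B C : ℕ} (pp : Prime p) (pq : Prime q) (pr : Prime r)
                     (p<q : p < q) (q<r : q < r) (0<A : 0 < A) (0<B : 0 < B) (0<C : 0 < C)
                     (m : ℕ) (n≡PQR : suc m ≡ p ^ A * q ^ B * r ^ C) where

  open import Data.Nat using (_≤_; _∸_; z≤n)
  open import Data.Nat.Properties using (<⇒≢; <-trans; ≤-refl; ≤-trans; m∸n≤m; n∸n≡0; m⊓n≤m; m⊓n≤n)
  open import Data.Nat.Divisibility using (∣-antisym; ∣-refl)
  open import Data.Nat.GCD using (gcd; gcd[m,n]∣m; gcd[m,n]∣n; gcd-greatest)
  open import Data.Nat.Coprimality using (coprime⇒gcd≡1)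
  open import Data.Sum using (_⊎_; inj₁; inj₂)
  open import Relation.Binary.PropositionalEquality using (trans; cong; subst)
  open PrimePowers using (prime>1; powDiv; coprime-pows)
  open LocalCounts using (configAt; belowPlusAbove; generators)
  open DegreeComparison using (_≽_; dominance; ≽⇒deg-≥)

  p≢q : p ≢ q
  p≢q = <⇒≢ p<q
  q≢r : q ≢ r
  q≢r = <⇒≢ q<r
  p≢r : p ≢ r
  p≢r = <⇒≢ (<-trans p<q q<r)

  open DegreeFormula.Primes pp pq pr p≢q (p≢r ∘ sym) (q≢r ∘ sym) A B C using (P; Q; R; degFormula)

  cfg : ℕ → ℕ → ℕ → LocalCounts.Config
  cfg = configAt p q r A B C

  Formula : Fin (suc m) → ℕ → ℕ → ℕ → Set
  Formula v s₁ s₂ s₃ = deg v + 1 + generators (cfg s₁ s₂ s₃) ≡ belowPlusAbove (cfg s₁ s₂ s₃)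

  gcd-idem : ∀ k → gcd k k ≡ k
  gcd-idem k = ∣-antisym (gcd[m,n]∣m k k) (gcd-greatest ∣-refl ∣-refl)

  -- v₂ = q^B has gcd(v₂, n) = q^B, so its order exponents are (A, 0, C).
  formula-v₂ : (v : Fin (suc m)) → toℕ v ≡ q ^ B → Formula v A 0 C
  formula-v₂ v v≡ = subst (λ s → Formula v A s C) (n∸n≡0 B)
    (degFormula m n≡PQR v 0 B 0 z≤n ≤-refl z≤n
      (trans (cong (λ t → gcd t P) v≡) (coprime⇒gcd≡1 (coprime-pows pq pp (p≢q ∘ sym) B A)))
      (trans (cong (λ t → gcd t Q) v≡) (gcd-idem Q))
      (trans (cong (λ t → gcd t R) v≡) (coprime⇒gcd≡1 (coprime-pows pq pr q≢r B C))))

  -- v₃ = r^C has order exponents (A, B, 0).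
  formula-v₃ : (v : Fin (suc m)) → toℕ v ≡ r ^ C → Formula v A B 0
  formula-v₃ v v≡ = subst (Formula v A B) (n∸n≡0 C)
    (degFormula m n≡PQR v 0 0 C z≤n z≤n ≤-refl
      (trans (cong (λ t → gcd t P) v≡) (coprime⇒gcd≡1 (coprime-pows pr pp (p≢r ∘ sym) C A)))
      (trans (cong (λ t → gcd t Q) v≡) (coprime⇒gcd≡1 (coprime-pows pr pq (q≢r ∘ sym) C B)))
      (trans (cong (λ t → gcd t R) v≡) (gcd-idem R)))

  lower-bound : (v₂ v₃ : Fin (suc m)) → toℕ v₂ ≡ q ^ B → toℕ v₃ ≡ r ^ C → ∀ a → deg v₂ ⊓ deg v₃ ≤ deg a
  lower-bound v₂ v₃ v₂≡ v₃≡ a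
    with powDiv pp A (gcd (toℕ a) P) (gcd[m,n]∣n (toℕ a) P)
       | powDiv pq B (gcd (toℕ a) Q) (gcd[m,n]∣n (toℕ a) Q)
       | powDiv pr C (gcd (toℕ a) R) (gcd[m,n]∣n (toℕ a) R)
  ... | x , x≤A , gx | y , y≤B , gy | z , z≤C , gz =
    conclude (dominance (prime>1 pp) p<q q<r 0<A 0<B 0<C (A ∸ x) (B ∸ y) (C ∸ z) (m∸n≤m A x) (m∸n≤m B y) (m∸n≤m C z))
    where
    cfg-a : LocalCounts.Config
    cfg-a = cfg (A ∸ x) (B ∸ y) (C ∸ z)
    formula-a : Formula a (A ∸ x) (B ∸ y) (C ∸ z)
    formula-a = degFormula m n≡PQR a x y z x≤A y≤B z≤C gx gy gz
    conclude : cfg-a ≽ cfg A 0 C ⊎ cfg-a ≽ cfg A B 0 → deg v₂ ⊓ deg v₃ ≤ deg a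
    conclude (inj₁ ≽v₂) = ≤-trans (m⊓n≤m (deg v₂) (deg v₃))
                                  (≽⇒deg-≥ cfg-a (cfg A 0 C) (deg a) (deg v₂) formula-a (formula-v₂ v₂ v₂≡) ≽v₂)
    conclude (inj₂ ≽v₃) = ≤-trans (m⊓n≤n (deg v₂) (deg v₃))
                                  (≽⇒deg-≥ cfg-a (cfg A B 0) (deg a) (deg v₃) formula-a (formula-v₃ v₃ v₃≡) ≽v₃)

theorem1p5 : (p₁ p₂ p₃ α₁ α₂ α₃ : ℕ) → Prime p₁ → Prime p₂ → Prime p₃ →
    p₁ < p₂ → p₂ < p₃ → 0 < α₁ → 0 < α₂ → 0 < α₃ →
    (n : ℕ) → n ≡ p₁ ^ α₁ * p₂ ^ α₂ * p₃ ^ α₃ →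
    (v₂ v₃ : Fin n) → toℕ v₂ ≡ p₂ ^ α₂ → toℕ v₃ ≡ p₃ ^ α₃ →
    IsMinDegree n (deg v₂ ⊓ deg v₃)
theorem1p5 p₁ p₂ p₃ α₁ α₂ α₃ pp₁ pp₂ pp₃ p₁<p₂ p₂<p₃ 0<α₁ 0<α₂ 0<α₃ (suc m) n≡ v₂ v₃ v₂≡ v₃≡ =
  MinimumDegree.lower-bound pp₁ pp₂ pp₃ p₁<p₂ p₂<p₃ 0<α₁ 0<α₂ 0<α₃ m n≡ v₂ v₃ v₂≡ v₃≡ , attained
  where
  attained : ∃ λ a → deg a ≡ deg v₂ ⊓ deg v₃
  attained with deg v₂ ≤? deg v₃
  ... | yes le = v₂ , sym (m≤n⇒m⊓n≡m le)
  ... | no nle = v₃ , sym (m≥n⇒m⊓n≡n (<⇒≤ (≰⇒> nle)))
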